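{- For all integers $m,n\ge 3$: $$T^{\mathsf{NE,SW}}_{m,n}=T_{m,n}-2=\binom{m+n}{m}-\binom{m+n-2}{m-1}-2;$$ $$T^{\mathsf{NE,SE}}_{m,n}=T^{\mathsf{SW,SE}}_{m,n}=T^{\mathsf{SE}}_{m,n}-1=\binom{m+n}{m}-2\binom{m+n-2}{m-1}-1;$$ $$T^{\mathsf{NE,SW,SE}}_{m,n}=T^{\mathsf{SE}}_{m,n}-2=\binom{m+n}{m}-2\binom{m+n-2}{m-1}-2.$$
   Context: A region is a finite set of unit squares of the square grid whose edge-adjacency graph is connected. A northwest corner of a region $R$ is a square of $R$ such that neither the square directly above it nor the square directly to its left belongs to $R$. A spotlight tiling of $R$ is produced recursively: choose a northwest corner $s$ of $R$ and place a spotlight with endpoint $s$, extending either east or south as far as possible, i.e. consisting of $s$ together with the maximal run of consecutive squares of $R$ in that direction. The uncovered squares form a disjoint union of regions (connected components), each of which is then given a spotlight tiling recursively; the empty region has exactly one (empty) tiling. The spotlight tiling is the final collection of spotlights; two spotlight tilings are the same if and only if they give the same collection of spotlights. $T_{m,n}$ is the number of spotlight tilings of the $m\times n$ rectangle. For a set $X$ of corner labels among NW, NE, SW, SE, $T^{X}_{m,n}$ is the number of spotlight tilings of the region obtained from the $m\times n$ rectangle by removing the corner squares listed in $X$ (e.g. $T^{\mathsf{NE,SE}}_{m,n}$: northeast and southeast corner squares removed; $T^{\mathsf{SE}}_{m,n}$: only the southeast corner square removed). -}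

module Defs where

open import Data.Nat using (ℕ; zero; suc; _+_; _∸_; _≤_; _<_; _≡ᵇ_; _≤ᵇ_; _<ᵇ_)
open import Data.Bool using (Bool; true; false; _∧_; not)
open import Data.Product using (Σ; _×_; _,_; proj₁; proj₂)
open import Data.Sum using (_⊎_)
open import Data.List using (List; []; _∷_; _++_; length)
open import Data.Bool.ListAction using (any)
open import Data.List.Membership.Propositional using (_∈_)
open import Data.List.Relation.Unary.All using (All)
open import Data.List.Relation.Unary.Any using (Any)
open import Data.List.Relation.Unary.AllPairs using (AllPairs)
open import Relation.Nullary using (¬_)
open import Relation.Binary.PropositionalEquality using (_≡_)

-- Squares of the grid: (row , column); rows increase downward (south),
-- columns increase to the right (east).  Every region considered lies
-- in the quadrant ℕ × ℕ (the rectangle is placed with its NW square at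
-- (0 , 0)).

Cell : Set
Cell = ℕ × ℕ

CellSet : Set
CellSet = Cell → Bool

_∈ᶜ_ : Cell → CellSet → Set
x ∈ᶜ X = X x ≡ true

_∉ᶜ_ : Cell → CellSet → Set
x ∉ᶜ X = X x ≡ false

IsEmpty : CellSet → Set
IsEmpty X = ∀ x → x ∉ᶜ X

_∖_ : CellSet → CellSet → CellSet
(X ∖ Y) x = X x ∧ not (Y x)

Adjacent : Cell → Cell → Set
Adjacent (r , c) (r' , c') =
  (r ≡ r' × (suc c ≡ c' ⊎ c ≡ suc c')) ⊎ (c ≡ c' × (suc r ≡ r' ⊎ r ≡ suc r'))

data Path (X : CellSet) : Cell → Cell → Set where
  here : ∀ {x} → x ∈ᶜ X → Path X x x
  step : ∀ {x y z} → x ∈ᶜ X → Adjacent x y → Path X y z → Path X x z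

Connected : CellSet → Set
Connected X = ∀ x y → x ∈ᶜ X → y ∈ᶜ X → Path X x y

-- C is a connected component of X: a nonempty connected subset of X
-- that is closed under adjacency inside X (i.e. a maximal connected subset).
IsComponent : CellSet → CellSet → Set
IsComponent C X =
  (∀ x → x ∈ᶜ C → x ∈ᶜ X) ×
  Σ Cell (λ x → x ∈ᶜ C) ×
  Connected C ×
  (∀ x y → x ∈ᶜ C → y ∈ᶜ X → Adjacent x y → y ∈ᶜ C)

-- A spotlight is a horizontal or vertical segment of squares, recorded
-- canonically by its first (NW-most) and last square; it covers exactly
-- the squares of the box spanned by these two squares.  (A one-square
-- spotlight is the same whether it was placed east or south.)
Spotlight : Set
Spotlight = Cell × Cell

inBox : Cell → Cell → Cell → Bool
inBox (a , b) (c , d) (x , y) = (a ≤ᵇ x) ∧ (x ≤ᵇ c) ∧ (b ≤ᵇ y) ∧ (y ≤ᵇ d)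

cellsOf : Spotlight → CellSet
cellsOf (s , e) = inBox s e

NWCorner : CellSet → Cell → Set
NWCorner X (r , c) =
  (r , c) ∈ᶜ X ×
  (∀ r' → r ≡ suc r' → (r' , c) ∉ᶜ X) ×
  (∀ c' → c ≡ suc c' → (r , c') ∉ᶜ X)

data MaxSpotlight (X : CellSet) : Cell → Spotlight → Set where
  east  : ∀ r c k →
          (∀ i → i ≤ k → (r , c + i) ∈ᶜ X) →
          (r , c + suc k) ∉ᶜ X →
          MaxSpotlight X (r , c) ((r , c) , (r , c + k))
  south : ∀ r c k →
          (∀ i → i ≤ k → (r + i , c) ∈ᶜ X) →
          (r + suc k , c) ∉ᶜ X →
          MaxSpotlight X (r , c) ((r , c) , (r + k , c))

mutual
  data SpotTiling (R : CellSet) : List Spotlight → Set where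
    place : ∀ {s L S} → NWCorner R s → MaxSpotlight R s L →
            ComponentsTiling (R ∖ cellsOf L) S →
            SpotTiling R (L ∷ S)

  data ComponentsTiling (X : CellSet) : List Spotlight → Set where
    done  : IsEmpty X → ComponentsTiling X []
    split : ∀ {S₁ S₂} (C : CellSet) → IsComponent C X →
            SpotTiling C S₁ → ComponentsTiling (X ∖ C) S₂ →
            ComponentsTiling X (S₁ ++ S₂)

_≈ᵗ_ : List Spotlight → List Spotlight → Set
S ≈ᵗ S' = ∀ L → (L ∈ S → L ∈ S') × (L ∈ S' → L ∈ S)

NumTilings : CellSet → ℕ → Set
NumTilings R k =
  Σ (List (List Spotlight)) λ Ts →
    length Ts ≡ k ×
    All (SpotTiling R) Ts ×
    AllPairs (λ S S' → ¬ (S ≈ᵗ S')) Ts ×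
    (∀ S → SpotTiling R S → Any (S ≈ᵗ_) Ts)

data Corner : Set where
  NW NE SW SE : Corner

cornerCell : ℕ → ℕ → Corner → Cell
cornerCell m n NW = (0 , 0)
cornerCell m n NE = (0 , n ∸ 1)
cornerCell m n SW = (m ∸ 1 , 0)
cornerCell m n SE = (m ∸ 1 , n ∸ 1)

cellEq : Cell → Cell → Bool
cellEq (a , b) (c , d) = (a ≡ᵇ c) ∧ (b ≡ᵇ d)

rect : ℕ → ℕ → CellSet
rect m n (r , c) = (r <ᵇ m) ∧ (c <ᵇ n)

rectMinus : ℕ → ℕ → List Corner → CellSet
rectMinus m n X x = rect m n x ∧ not (any (λ k → cellEq (cornerCell m n k) x) X)

module Submission where

-- Every region R met here has a unique northwest corner p, so a tiling of
-- R places the maximal east spotlight Le or the maximal south spotlight Ls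
-- at p first and then tiles the leftover; hence #R = #(R ∖ Le) + #(R ∖ Ls),
-- or #R = #(R ∖ Le) when Le = Ls ('UniqueCornerStep').  The regions are
-- "cut rectangles" — a rectangle minus a choice of its NE, SW, SE corner
-- squares — presented as row-interval regions ('Reg', 'Staircase'); such
-- a region is connected, has (a , lo a) as its only NW corner, and both
-- leftovers are again cut rectangles (one row shorter, resp. one column
-- narrower).  Finally 'count' satisfies the
-- closed forms of the statement: unfolding its recursion, cutting NE or
-- SW costs one tiling, cutting SE costs (m + n − 2 choose m − 1), and the
-- uncut count plus that binomial satisfies Pascal's rule.

open import Defs
open import Data.Nat using (ℕ; zero; suc; pred; _+_; _*_; _∸_; _≤_; _<_; _≟_; _≤?_; z≤n; s≤s; _≤ᵇ_; _<ᵇ_; _≡ᵇ_)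
open import Data.Nat.Properties
open import Algebra.Properties.CommutativeSemigroup +-commutativeSemigroup using () renaming (interchange to +-interchange)
open import Data.Nat.Combinatorics using (_C_; nCk+nC[k+1]≡[n+1]C[k+1]; nCk≡nC[n∸k]; nCn≡1)
open import Data.Bool using (Bool; true; false; _∧_; _∨_; not; T)
open import Data.Bool.ListAction using (any)
open import Data.Unit using (tt)
open import Data.Product using (Σ; Σ-syntax; _×_; _,_; proj₁; proj₂)
open import Data.Product.Properties using (≡-dec)
open import Data.Sum using (_⊎_; inj₁; inj₂; [_,_])
open import Data.List using (List; []; _∷_; _++_; length; map)
open import Data.List.Properties using (++-identityʳ; length-++; length-map)
open import Data.List.Membership.Propositional using (_∈_)
open import Data.List.Membership.Propositional.Properties using (∈-++⁻)
open import Data.List.Relation.Unary.All as All using (All; []; _∷_)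
import Data.List.Relation.Unary.All.Properties as AllP
open import Data.List.Relation.Unary.Any as Any using (Any; here; there)
import Data.List.Relation.Unary.Any.Properties as AnyP
open import Data.List.Relation.Unary.AllPairs using (AllPairs; []; _∷_)
import Data.List.Relation.Unary.AllPairs.Properties as AllPairsP
open import Data.Empty using (⊥; ⊥-elim)
open import Relation.Nullary using (¬_; Dec; yes; no)
open import Relation.Binary.PropositionalEquality hiding ([_])
open import Relation.Binary.Definitions using (tri<; tri≈; tri>)

∧-l : ∀ {a b} → a ∧ b ≡ true → a ≡ true
∧-l {true} _ = refl

∧-r : ∀ {a b} → a ∧ b ≡ true → b ≡ true
∧-r {true} p = p

∧-intro : ∀ {a b} → a ≡ true → b ≡ true → a ∧ b ≡ true
∧-intro refl refl = refl

not-true : ∀ {a} → not a ≡ true → a ≡ false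
not-true {false} _ = refl

not-intro : ∀ {a} → a ≡ false → not a ≡ true
not-intro refl = refl

true≢false : ∀ {a} → a ≡ true → a ≡ false → ⊥
true≢false refl ()

¬true⇒false : ∀ {a} → ¬ (a ≡ true) → a ≡ false
¬true⇒false {true} h = ⊥-elim (h refl)
¬true⇒false {false} h = refl

bool-ext : ∀ {a b : Bool} → (a ≡ true → b ≡ true) → (b ≡ true → a ≡ true) → a ≡ b
bool-ext {true} {true} f g = refl
bool-ext {true} {false} f g = sym (f refl)
bool-ext {false} {true} f g = g refl
bool-ext {false} {false} f g = refl

T⇒true : ∀ {b} → T b → b ≡ true
T⇒true {true} _ = refl

true⇒T : ∀ {b} → b ≡ true → T b
true⇒T refl = tt

inBox-elim : ∀ {a b c d x y} → inBox (a , b) (c , d) (x , y) ≡ true → a ≤ x × x ≤ c × b ≤ y × y ≤ d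
inBox-elim {a} {b} {c} {d} {x} {y} e =
  ≤ᵇ⇒≤ a x (true⇒T (∧-l e)) ,
  ≤ᵇ⇒≤ x c (true⇒T (∧-l (∧-r {a ≤ᵇ x} e))) ,
  ≤ᵇ⇒≤ b y (true⇒T (∧-l (∧-r {x ≤ᵇ c} (∧-r {a ≤ᵇ x} e)))) ,
  ≤ᵇ⇒≤ y d (true⇒T (∧-r {b ≤ᵇ y} (∧-r {x ≤ᵇ c} (∧-r {a ≤ᵇ x} e))))

inBox-intro : ∀ {a b c d x y} → a ≤ x → x ≤ c → b ≤ y → y ≤ d → inBox (a , b) (c , d) (x , y) ≡ true
inBox-intro p q r s = ∧-intro (T⇒true (≤⇒≤ᵇ p)) (∧-intro (T⇒true (≤⇒≤ᵇ q)) (∧-intro (T⇒true (≤⇒≤ᵇ r)) (T⇒true (≤⇒≤ᵇ s))))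

∖-elim : ∀ {X Y x} → (X ∖ Y) x ≡ true → x ∈ᶜ X × x ∉ᶜ Y
∖-elim {X} e = ∧-l e , not-true (∧-r {X _} e)

∖-intro : ∀ {X Y x} → x ∈ᶜ X → x ∉ᶜ Y → (X ∖ Y) x ≡ true
∖-intro p q = ∧-intro p (not-intro q)

-- Every notion of Defs only looks at
-- membership, so tilings and tiling counts transfer along _≐_; this lets
-- us identify the leftover of a spotlight with a region of a fixed shape.

_≐_ : CellSet → CellSet → Set
X ≐ Y = ∀ x → X x ≡ Y x

≐-sym : ∀ {X Y} → X ≐ Y → Y ≐ X
≐-sym e x = sym (e x)

≐-trans : ∀ {X Y Z} → X ≐ Y → Y ≐ Z → X ≐ Z
≐-trans e f x = trans (e x) (f x)

∖-congˡ : ∀ {X Y} Z → X ≐ Y → (X ∖ Z) ≐ (Y ∖ Z)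
∖-congˡ Z e x = cong (λ b → b ∧ not (Z x)) (e x)

∈-resp : ∀ {X Y} → X ≐ Y → ∀ {x} → x ∈ᶜ X → x ∈ᶜ Y
∈-resp e {x} p = trans (sym (e x)) p

∉-resp : ∀ {X Y} → X ≐ Y → ∀ {x} → x ∉ᶜ X → x ∉ᶜ Y
∉-resp e {x} p = trans (sym (e x)) p

NWCorner-resp : ∀ {X Y} → X ≐ Y → ∀ {s} → NWCorner X s → NWCorner Y s
NWCorner-resp e (sX , up , left) =
  ∈-resp e sX , (λ r' q → ∉-resp e (up r' q)) , (λ c' q → ∉-resp e (left c' q))

MaxSpotlight-resp : ∀ {X Y} → X ≐ Y → ∀ {s L} → MaxSpotlight X s L → MaxSpotlight Y s L
MaxSpotlight-resp e (east r c k run stop) = east r c k (λ i q → ∈-resp e (run i q)) (∉-resp e stop)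
MaxSpotlight-resp e (south r c k run stop) = south r c k (λ i q → ∈-resp e (run i q)) (∉-resp e stop)

IsComponent-resp : ∀ {X Y D} → X ≐ Y → IsComponent D X → IsComponent D Y
IsComponent-resp e (sub , inhabited , conn , closed) =
  (λ x p → ∈-resp e (sub x p)) , inhabited , conn ,
  (λ x y p q a → closed x y p (∈-resp (≐-sym e) q) a)

mutual
  SpotTiling-resp : ∀ {X Y} → X ≐ Y → ∀ {S} → SpotTiling X S → SpotTiling Y S
  SpotTiling-resp e (place {L = L} nw ms ct) =
    place (NWCorner-resp e nw) (MaxSpotlight-resp e ms) (ComponentsTiling-resp (∖-congˡ (cellsOf L) e) ct)

  ComponentsTiling-resp : ∀ {X Y} → X ≐ Y → ∀ {S} → ComponentsTiling X S → ComponentsTiling Y S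
  ComponentsTiling-resp e (done em) = done (λ x → ∉-resp e (em x))
  ComponentsTiling-resp e (split D comp st ct) =
    split D (IsComponent-resp e comp) st (ComponentsTiling-resp (∖-congˡ D e) ct)

-- NumTilingsᶜ X k: X has exactly k distinct tilings in the sense of
-- ComponentsTiling (every component tiled separately); this is the count
-- the recursion produces for the leftover of a spotlight.
NumTilingsᶜ : CellSet → ℕ → Set
NumTilingsᶜ X k =
  Σ (List (List Spotlight)) λ Ts →
    length Ts ≡ k ×
    All (ComponentsTiling X) Ts ×
    AllPairs (λ S S' → ¬ (S ≈ᵗ S')) Ts ×
    (∀ S → ComponentsTiling X S → Any (S ≈ᵗ_) Ts)

NumTilings-resp : ∀ {X Y k} → X ≐ Y → NumTilings X k → NumTilings Y k
NumTilings-resp e (Ts , len , valid , distinct , complete) =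
  Ts , len , All.map (SpotTiling-resp e) valid , distinct ,
  (λ S s → complete S (SpotTiling-resp (≐-sym e) s))

NumTilingsᶜ-resp : ∀ {X Y k} → X ≐ Y → NumTilingsᶜ X k → NumTilingsᶜ Y k
NumTilingsᶜ-resp e (Ts , len , valid , distinct , complete) =
  Ts , len , All.map (ComponentsTiling-resp e) valid , distinct ,
  (λ S s → complete S (ComponentsTiling-resp (≐-sym e) s))

pathStart : ∀ {X x y} → Path X x y → x ∈ᶜ X
pathStart (here p) = p
pathStart (step p _ _) = p

path-snoc : ∀ {X u y x} → Path X u y → Adjacent y x → x ∈ᶜ X → Path X u x
path-snoc (here u) adj xX = step u adj (here xX)
path-snoc (step q a' rest) adj xX = step q a' (path-snoc rest adj xX)

path-++ : ∀ {X x y z} → Path X x y → Path X y z → Path X x z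
path-++ (here _) q = q
path-++ (step q a' rest) r = step q a' (path-++ rest r)

closed-path : ∀ {D X} → (∀ x y → x ∈ᶜ D → y ∈ᶜ X → Adjacent x y → y ∈ᶜ D) →
              ∀ {y z} → Path X y z → y ∈ᶜ D → z ∈ᶜ D
closed-path cl (here _) yC = yC
closed-path cl (step {x} {y} p a q) xC = closed-path cl q (cl x y xC (pathStart q) a)

component-of-connected : ∀ {X D} → Connected X → IsComponent D X → X ≐ D
component-of-connected conn (sub , (c , cC) , _ , closed) x =
  bool-ext (λ xX → closed-path closed (conn c x (sub c cC) xX) cC) (sub x)

diff-self-empty : ∀ {X D} → X ≐ D → IsEmpty (X ∖ D)
diff-self-empty {X} {D} e x rewrite e x with D x
... | true = refl
... | false = refl

ComponentsTiling-empty : ∀ {X S} → IsEmpty X → ComponentsTiling X S → S ≡ []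
ComponentsTiling-empty em (done _) = refl
ComponentsTiling-empty em (split D (sub , (x , xC) , _) _ _) = ⊥-elim (true≢false (sub x xC) (em x))

connected-ct⇒st : ∀ {X S p} → Connected X → p ∈ᶜ X → ComponentsTiling X S → SpotTiling X S
connected-ct⇒st {p = p} conn pX (done em) = ⊥-elim (true≢false pX (em p))
connected-ct⇒st {X} conn pX (split {S₁} D comp st ct)
  with component-of-connected conn comp
... | e rewrite ComponentsTiling-empty (diff-self-empty {X} {D} e) ct | ++-identityʳ S₁ =
  SpotTiling-resp (≐-sym e) st

connected-st⇒ct : ∀ {X S p} → Connected X → p ∈ᶜ X → SpotTiling X S → ComponentsTiling X S
connected-st⇒ct {X} {S} {p} conn pX st =
  subst (ComponentsTiling X) (++-identityʳ S)
    (split X ((λ x q → q) , (p , pX) , conn , (λ x y _ q _ → q)) st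
      (done (diff-self-empty {X} {X} (λ _ → refl))))

connected-count : ∀ {X k p} → Connected X → p ∈ᶜ X → NumTilings X k → NumTilingsᶜ X k
connected-count conn pX (Ts , len , valid , distinct , complete) =
  Ts , len , All.map (connected-st⇒ct conn pX) valid , distinct ,
  (λ S c → complete S (connected-ct⇒st conn pX c))

≈ᵗ-refl : ∀ {S} → S ≈ᵗ S
≈ᵗ-refl L = (λ x → x) , (λ x → x)

empty-count : ∀ {X} → IsEmpty X → NumTilingsᶜ X 1
empty-count em = ([] ∷ []) , refl , (done em ∷ []) , ([] ∷ []) ,
  (λ S c → here (subst (_≈ᵗ []) (sym (ComponentsTiling-empty em c)) ≈ᵗ-refl))

MaxSpotlight-start : ∀ {X s L} → MaxSpotlight X s L → proj₁ L ≡ s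
MaxSpotlight-start (east r c k _ _) = refl
MaxSpotlight-start (south r c k _ _) = refl

MaxSpotlight-covers-start : ∀ {X s L} → MaxSpotlight X s L → s ∈ᶜ cellsOf L
MaxSpotlight-covers-start (east r c k _ _) = inBox-intro (≤-refl {r}) (≤-refl {r}) (≤-refl {c}) (m≤m+n c k)
MaxSpotlight-covers-start (south r c k _ _) = inBox-intro (≤-refl {r}) (m≤m+n r k) (≤-refl {c}) (≤-refl {c})

mutual
  SpotTiling-start : ∀ {X S L} → SpotTiling X S → L ∈ S → proj₁ L ∈ᶜ X
  SpotTiling-start {X} (place (sX , _) ms ct) (here refl) = subst (_∈ᶜ X) (sym (MaxSpotlight-start ms)) sX
  SpotTiling-start (place nw ms ct) (there i) = ∧-l (ComponentsTiling-start ct i)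

  ComponentsTiling-start : ∀ {X S L} → ComponentsTiling X S → L ∈ S → proj₁ L ∈ᶜ X
  ComponentsTiling-start (done _) ()
  ComponentsTiling-start (split {S₁} D (sub , _) st ct) i with ∈-++⁻ S₁ i
  ... | inj₁ j = sub _ (SpotTiling-start st j)
  ... | inj₂ j = ∧-l (ComponentsTiling-start ct j)

maximal-run-unique : ∀ (P : ℕ → Set) {k k'} → (∀ i → i ≤ k → P i) → ¬ P (suc k) →
                     (∀ i → i ≤ k' → P i) → ¬ P (suc k') → k ≡ k'
maximal-run-unique P {k} {k'} run stop run' stop' with <-cmp k k'
... | tri< lt _ _ = ⊥-elim (stop (run' (suc k) lt))
... | tri≈ _ eq _ = eq
... | tri> _ _ gt = ⊥-elim (stop' (run (suc k') gt))

_≉ᵗ_ : List Spotlight → List Spotlight → Set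
S ≉ᵗ S' = ¬ (S ≈ᵗ S')

≈ᵗ-cons : ∀ {L S S'} → S ≈ᵗ S' → (L ∷ S) ≈ᵗ (L ∷ S')
≈ᵗ-cons h x = (λ { (here e) → here e ; (there i) → there (proj₁ (h x) i) }) ,
              (λ { (here e) → here e ; (there i) → there (proj₂ (h x) i) })

≉ᵗ-cons : ∀ {L S S'} → ¬ (L ∈ S) → ¬ (L ∈ S') → S ≉ᵗ S' → (L ∷ S) ≉ᵗ (L ∷ S')
≉ᵗ-cons {L} nS nS' ne h = ne (λ x →
  (λ i → drop-L (proj₁ (h x) (there i)) nS i) ,
  (λ i → drop-L (proj₂ (h x) (there i)) nS' i))
  where
  drop-L : ∀ {x A B} → x ∈ L ∷ B → ¬ (L ∈ A) → x ∈ A → x ∈ B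
  drop-L (here refl) nA i = ⊥-elim (nA i)
  drop-L (there j) nA i = j

prepend-distinct : ∀ {L Ts} → All (λ S → ¬ (L ∈ S)) Ts → AllPairs _≉ᵗ_ Ts →
                   AllPairs _≉ᵗ_ (map (L ∷_) Ts)
prepend-distinct [] [] = []
prepend-distinct (n ∷ ns) (h ∷ hs) = AllP.map⁺ (pairs n ns h) ∷ prepend-distinct ns hs
  where
  pairs : ∀ {L S Us} → ¬ (L ∈ S) → All (λ S → ¬ (L ∈ S)) Us → All (S ≉ᵗ_) Us →
          All (λ S' → (L ∷ S) ≉ᵗ (L ∷ S')) Us
  pairs n [] [] = []
  pairs n (m ∷ ms) (h ∷ hs) = ≉ᵗ-cons n m h ∷ pairs n ms hs

prepend-complete : ∀ {L S Ts} → Any (S ≈ᵗ_) Ts → Any ((L ∷ S) ≈ᵗ_) (map (L ∷_) Ts)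
prepend-complete h = AnyP.map⁺ (Any.map ≈ᵗ-cons h)

-- Let R have a unique northwest corner p, with
-- maximal east spotlight Le and maximal south spotlight Ls.  Every tiling
-- of R places Le or Ls first and then tiles the leftover, so
--   #tilings R = #tilingsᶜ (R ∖ Le) + #tilingsᶜ (R ∖ Ls)   if Le ≠ Ls,
--   #tilings R = #tilingsᶜ (R ∖ Le)                          if Le = Ls.

module UniqueCornerStep (R : CellSet) (a c₀ : ℕ)
  (corner : NWCorner R (a , c₀)) (unique : ∀ s → NWCorner R s → s ≡ (a , c₀))
  (ke : ℕ) (east-in : ∀ i → i ≤ ke → (a , c₀ + i) ∈ᶜ R) (east-stop : (a , c₀ + suc ke) ∉ᶜ R)
  (ks : ℕ) (south-in : ∀ i → i ≤ ks → (a + i , c₀) ∈ᶜ R) (south-stop : (a + suc ks , c₀) ∉ᶜ R) where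

  Le Ls : Spotlight
  Le = ((a , c₀) , (a , c₀ + ke))
  Ls = ((a , c₀) , (a + ks , c₀))

  maxE : MaxSpotlight R (a , c₀) Le
  maxE = east a c₀ ke east-in east-stop

  maxS : MaxSpotlight R (a , c₀) Ls
  maxS = south a c₀ ks south-in south-stop

  max-spotlights : ∀ {L} → MaxSpotlight R (a , c₀) L → L ≡ Le ⊎ L ≡ Ls
  max-spotlights (east _ _ k run stop) =
    inj₁ (cong (λ k → ((a , c₀) , (a , c₀ + k)))
      (maximal-run-unique (λ i → (a , c₀ + i) ∈ᶜ R) run (λ q → true≢false q stop)
                          east-in (λ q → true≢false q east-stop)))
  max-spotlights (south _ _ k run stop) =
    inj₂ (cong (λ k → ((a , c₀) , (a + k , c₀)))
      (maximal-run-unique (λ i → (a + i , c₀) ∈ᶜ R) run (λ q → true≢false q stop)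
                          south-in (λ q → true≢false q south-stop)))

  fresh : ∀ {L L' S} → MaxSpotlight R (a , c₀) L → ComponentsTiling (R ∖ cellsOf L) S →
          proj₁ L' ≡ (a , c₀) → ¬ (L' ∈ S)
  fresh {L} ms ct e i with ComponentsTiling-start ct i
  ... | q rewrite e = true≢false (MaxSpotlight-covers-start ms) (not-true (∧-r {R (a , c₀)} q))

  Prefixed : Spotlight → List (List Spotlight) → Set
  Prefixed L Us =
    All (SpotTiling R) Us × AllPairs _≉ᵗ_ Us ×
    (∀ S → ComponentsTiling (R ∖ cellsOf L) S → Any ((L ∷ S) ≈ᵗ_) Us)

  prefixed : ∀ {L k} → MaxSpotlight R (a , c₀) L → ((Ts , _) : NumTilingsᶜ (R ∖ cellsOf L) k) →
             Prefixed L (map (L ∷_) Ts)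
  prefixed ms (Ts , _ , valid , distinct , complete) =
    AllP.map⁺ (All.map (place corner ms) valid) ,
    prepend-distinct (All.map (λ ct → fresh ms ct (MaxSpotlight-start ms)) valid) distinct ,
    (λ S ct → prepend-complete (complete S ct))

  count-same : ∀ {k} → Le ≡ Ls → NumTilingsᶜ (R ∖ cellsOf Le) k → NumTilings R k
  count-same eq N@(Ts , len , _) with prefixed maxE N
  ... | (valid , distinct , complete) = map (Le ∷_) Ts , trans (length-map _ Ts) len , valid , distinct , every
    where
    every : ∀ S → SpotTiling R S → Any (S ≈ᵗ_) (map (Le ∷_) Ts)
    every _ (place {s} {L} {S} nw ms ct) with unique s nw
    ... | refl with max-spotlights ms
    ... | inj₁ refl = complete S ct
    ... | inj₂ refl = subst (λ L → Any ((L ∷ S) ≈ᵗ_) (map (Le ∷_) Ts)) eq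
                        (complete S (subst (λ L → ComponentsTiling (R ∖ cellsOf L) S) (sym eq) ct))

  count-diff : ∀ {ke' ks'} → ¬ (Le ≡ Ls) →
               NumTilingsᶜ (R ∖ cellsOf Le) ke' → NumTilingsᶜ (R ∖ cellsOf Ls) ks' →
               NumTilings R (ke' + ks')
  count-diff neq Nᵉ@(Ts , lenE , _) Nˢ@(Us , lenS , validS , _) with prefixed maxE Nᵉ | prefixed maxS Nˢ
  ... | (tilingsE , distinctE , completeE) | (tilingsS , distinctS , completeS) =
    map (Le ∷_) Ts ++ map (Ls ∷_) Us ,
    trans (length-++ (map (Le ∷_) Ts)) (cong₂ _+_ (trans (length-map _ Ts) lenE) (trans (length-map _ Us) lenS)) ,
    AllP.++⁺ tilingsE tilingsS ,
    AllPairsP.++⁺ distinctE distinctS (AllP.map⁺ (All.universal (λ _ → AllP.map⁺ (All.map cross validS)) Ts)) ,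
    every
    where
    cross : ∀ {S S'} → ComponentsTiling (R ∖ cellsOf Ls) S' → (Le ∷ S) ≉ᵗ (Ls ∷ S')
    cross ct h with proj₁ (h Le) (here refl)
    ... | here e = neq e
    ... | there i = fresh maxS ct refl i
    every : ∀ S → SpotTiling R S → Any (S ≈ᵗ_) (map (Le ∷_) Ts ++ map (Ls ∷_) Us)
    every _ (place {s} {L} {S} nw ms ct) with unique s nw
    ... | refl with max-spotlights ms
    ... | inj₁ refl = AnyP.++⁺ˡ (completeE S ct)
    ... | inj₂ refl = AnyP.++⁺ʳ (map (Le ∷_) Ts) (completeS S ct)

Reg : (ℕ → ℕ) → (ℕ → ℕ) → CellSet
Reg lo hi (r , c) = (lo r ≤ᵇ c) ∧ (c <ᵇ hi r)

module _ {lo hi : ℕ → ℕ} where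
  Reg-intro : ∀ {r c} → lo r ≤ c → c < hi r → (r , c) ∈ᶜ Reg lo hi
  Reg-intro p q = ∧-intro (T⇒true (≤⇒≤ᵇ p)) (T⇒true (<⇒<ᵇ q))

  Reg-elim : ∀ {r c} → (r , c) ∈ᶜ Reg lo hi → lo r ≤ c × c < hi r
  Reg-elim {r} {c} e = ≤ᵇ⇒≤ (lo r) c (true⇒T (∧-l e)) , <ᵇ⇒< c (hi r) (true⇒T (∧-r {lo r ≤ᵇ c} e))

  Reg-out : ∀ {r c} → (lo r ≤ c → c < hi r → ⊥) → (r , c) ∉ᶜ Reg lo hi
  Reg-out h = ¬true⇒false (λ e → h (proj₁ (Reg-elim e)) (proj₂ (Reg-elim e)))

SameRow : ℕ → ℕ → ℕ → ℕ → Set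
SameRow l h l' h' = (l ≡ l' × h ≡ h') ⊎ (h ≤ l × h' ≤ l')

SameRow-in : ∀ {l h l' h' c} → SameRow l h l' h' → l ≤ c → c < h → l' ≤ c × c < h'
SameRow-in (inj₁ (refl , refl)) p q = p , q
SameRow-in (inj₂ (e , _)) p q = ⊥-elim (<-irrefl refl (<-≤-trans q (≤-trans e p)))

SameRow-sym : ∀ {l h l' h'} → SameRow l h l' h' → SameRow l' h' l h
SameRow-sym (inj₁ (refl , refl)) = inj₁ (refl , refl)
SameRow-sym (inj₂ (e , f)) = inj₂ (f , e)

Reg-cong : ∀ {lo hi lo' hi'} → (∀ r → SameRow (lo r) (hi r) (lo' r) (hi' r)) → Reg lo hi ≐ Reg lo' hi'
Reg-cong {lo} {hi} {lo'} {hi'} same (r , c) = bool-ext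
  (λ e → let (p , q) = SameRow-in (same r) (proj₁ (Reg-elim {lo} {hi} e)) (proj₂ (Reg-elim {lo} {hi} e))
         in Reg-intro {lo'} {hi'} p q)
  (λ e → let (p , q) = SameRow-in (SameRow-sym (same r)) (proj₁ (Reg-elim {lo'} {hi'} e)) (proj₂ (Reg-elim {lo'} {hi'} e))
         in Reg-intro {lo} {hi} p q)

Reg-empty : ∀ {lo hi} → (∀ r → hi r ≤ lo r) → IsEmpty (Reg lo hi)
Reg-empty {lo} {hi} h (r , c) = Reg-out {lo} {hi} (λ p q → <-irrefl refl (<-≤-trans q (≤-trans (h r) p)))

module Staircase (lo hi : ℕ → ℕ) (a : ℕ)
  (above-empty : ∀ r → r < a → hi r ≤ lo r)
  (top-nonempty : lo a < hi a)
  (steps : ∀ r → a ≤ r → lo (suc r) < hi (suc r) → lo r ≤ lo (suc r) × lo (suc r) < hi r) where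

  R : CellSet
  R = Reg lo hi

  p : Cell
  p = (a , lo a)

  p∈R : p ∈ᶜ R
  p∈R = Reg-intro {lo} {hi} ≤-refl top-nonempty

  above-out : ∀ {r c} → r < a → (r , c) ∉ᶜ R
  above-out lt = Reg-out {lo} {hi} (λ x y → <-irrefl refl (<-≤-trans y (≤-trans (above-empty _ lt) x)))

  -- p is a northwest corner, and the only one: every other square has an
  -- upper or left neighbour in R
  p-corner : NWCorner R p
  p-corner = p∈R , (λ r' e → above-out (subst (r' <_) (sym e) ≤-refl)) ,
             (λ c' e → Reg-out {lo} {hi} (λ x _ → <-irrefl refl (≤-<-trans x (subst (c' <_) (sym e) ≤-refl))))

  HasPredecessor : Cell → Set
  HasPredecessor (r , c) =
    (Σ ℕ λ r' → r ≡ suc r' × (r' , c) ∈ᶜ R) ⊎ (Σ ℕ λ c' → c ≡ suc c' × (r , c') ∈ᶜ R)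

  predecessor : ∀ r c → (r , c) ∈ᶜ R → ¬ ((r , c) ≡ p) → HasPredecessor (r , c)
  predecessor r c e ne with Reg-elim {lo} {hi} e
  ... | (l≤c , c<h) with m≤n⇒m<n∨m≡n l≤c
  ... | inj₁ lt = left c lt c<h
    where
    left : ∀ c → lo r < c → c < hi r → HasPredecessor (r , c)
    left (suc c') (s≤s l≤c') c<h = inj₂ (c' , refl , Reg-intro {lo} {hi} l≤c' (<-trans (n<1+n c') c<h))
  ... | inj₂ eq with <-cmp r a
  ... | tri< lt _ _ = ⊥-elim (true≢false e (above-out lt))
  ... | tri≈ _ refl _ = ⊥-elim (ne (cong (a ,_) (sym eq)))
  ... | tri> _ _ gt = up r gt eq c<h
    where
    up : ∀ r → a < r → lo r ≡ c → c < hi r → HasPredecessor (r , c)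
    up (suc r') (s≤s a≤r') eq c<h =
      let (x , y) = steps r' a≤r' (subst (_< hi (suc r')) (sym eq) c<h) in
      inj₁ (r' , refl , Reg-intro {lo} {hi} (≤-trans x (≤-reflexive eq)) (subst (_< hi r') eq y))

  p-unique : ∀ s → NWCorner R s → s ≡ p
  p-unique (r , c) (sR , up , left) with ≡-dec _≟_ _≟_ (r , c) p
  ... | yes e = e
  ... | no ne with predecessor r c sR ne
  ... | inj₁ (r' , e , q) = ⊥-elim (true≢false q (up r' e))
  ... | inj₂ (c' , e , q) = ⊥-elim (true≢false q (left c' e))

  -- following predecessors leads from every square to p and back
  -- (induction on the bound n of r + c)
  reach-p : ∀ n r c → r + c ≤ n → (r , c) ∈ᶜ R → Path R (r , c) p × Path R p (r , c)
  reach-p n r c le e with ≡-dec _≟_ _≟_ (r , c) p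
  ... | yes refl = here e , here e
  ... | no ne with predecessor r c e ne | n
  ... | inj₁ (r' , refl , q) | zero = ⊥-elim (1+n≰n (≤-trans le z≤n))
  ... | inj₂ (c' , refl , q) | zero = ⊥-elim (1+n≰n (≤-trans (≤-reflexive (sym (+-suc r c'))) (≤-trans le z≤n)))
  ... | inj₁ (r' , refl , q) | suc n' =
    let (f , g) = reach-p n' r' c (≤-pred le) q in
    step e (inj₂ (refl , inj₂ refl)) f , path-snoc g (inj₂ (refl , inj₁ refl)) e
  ... | inj₂ (c' , refl , q) | suc n' =
    let (f , g) = reach-p n' r c' (≤-pred (≤-trans (≤-reflexive (sym (+-suc r c'))) le)) q in
    step e (inj₁ (refl , inj₂ refl)) f , path-snoc g (inj₁ (refl , inj₁ refl)) e

  connected : Connected R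
  connected (r , c) (r' , c') e e' =
    path-++ (proj₁ (reach-p (r + c) r c ≤-refl e)) (proj₂ (reach-p (r' + c') r' c' ≤-refl e'))

  leftover-untouched : ∀ {L lo' hi' r c} → (r , c) ∉ᶜ cellsOf L →
                       SameRow (lo r) (hi r) (lo' r) (hi' r) → (R ∖ cellsOf L) (r , c) ≡ Reg lo' hi' (r , c)
  leftover-untouched {L} {lo'} {hi'} {r} {c} notL same = bool-ext
    (λ e → let (l , h) = Reg-elim {lo} {hi} (proj₁ (∖-elim {R} {cellsOf L} e))
               (l' , h') = SameRow-in same l h in Reg-intro {lo'} {hi'} l' h')
    (λ e → let (l , h) = Reg-elim {lo'} {hi'} e
               (l' , h') = SameRow-in (SameRow-sym same) l h in
           ∖-intro {R} {cellsOf L} (Reg-intro {lo} {hi} l' h') notL)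

  -- the east spotlight at p is the whole top row
  ke : ℕ
  ke = hi a ∸ suc (lo a)

  ke-end : lo a + suc ke ≡ hi a
  ke-end = trans (+-suc (lo a) ke) (m+[n∸m]≡n top-nonempty)

  east-in : ∀ i → i ≤ ke → (a , lo a + i) ∈ᶜ R
  east-in i le = Reg-intro {lo} {hi} (m≤m+n (lo a) i) (subst (lo a + i <_) ke-end (+-monoʳ-< (lo a) (s≤s le)))

  east-stop : (a , lo a + suc ke) ∉ᶜ R
  east-stop = Reg-out {lo} {hi} (λ _ q → <-irrefl ke-end q)

  Le : Spotlight
  Le = (p , (a , lo a + ke))

  east-leftover : ∀ {lo' hi'} → hi' a ≤ lo' a →
                  (∀ r → ¬ (r ≡ a) → SameRow (lo r) (hi r) (lo' r) (hi' r)) →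
                  (R ∖ cellsOf Le) ≐ Reg lo' hi'
  east-leftover {lo'} {hi'} row-a-empty others (r , c) with r ≟ a
  ... | yes refl = bool-ext
      (λ e → let (x , y) = ∖-elim {R} {cellsOf Le} e
                 (l , h) = Reg-elim {lo} {hi} x
             in ⊥-elim (true≢false (inBox-intro {a} {lo a} {a} {lo a + ke} {a} {c} ≤-refl ≤-refl l
                    (≤-pred (subst (c <_) (trans (sym ke-end) (+-suc (lo a) ke)) h))) y))
      (λ e → let (l , h) = Reg-elim {lo'} {hi'} e in ⊥-elim (<-irrefl refl (<-≤-trans h (≤-trans row-a-empty l))))
  ... | no ne = leftover-untouched {Le} {lo'} {hi'} (¬true⇒false (λ ib →
                  let (u , v , _) = inBox-elim {a} {lo a} {a} {lo a + ke} {r} {c} ib in ne (≤-antisym v u)))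
                (others r ne)

  module SouthSpotlight (ks : ℕ) where
    Ls : Spotlight
    Ls = (p , (a + ks , lo a))

    south-leftover-column : ∀ {lo' hi' r c} → a ≤ r → r ≤ a + ks → lo r ≡ lo a →
                            SameRow (suc (lo r)) (hi r) (lo' r) (hi' r) →
                            (R ∖ cellsOf Ls) (r , c) ≡ Reg lo' hi' (r , c)
    south-leftover-column {lo'} {hi'} {r} {c} ar rk lo-r same = bool-ext
      (λ e → let (x , y) = ∖-elim {R} {cellsOf Ls} e
                 (l , h) = Reg-elim {lo} {hi} x
                 l<c : suc (lo r) ≤ c
                 l<c = ≤∧≢⇒< l (λ eq → true≢false (inBox-intro {a} {lo a} {a + ks} {lo a} {r} {c} ar rk
                         (≤-reflexive (trans (sym lo-r) eq)) (≤-reflexive (trans (sym eq) lo-r))) y)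
                 (l' , h') = SameRow-in same l<c h in Reg-intro {lo'} {hi'} l' h')
      (λ e → let (l , h) = Reg-elim {lo'} {hi'} e
                 (l' , h') = SameRow-in (SameRow-sym same) l h in
             ∖-intro {R} {cellsOf Ls} (Reg-intro {lo} {hi} (<⇒≤ l') h')
               (¬true⇒false (λ ib → let (_ , _ , _ , v) = inBox-elim {a} {lo a} {a + ks} {lo a} {r} {c} ib in
                  <-irrefl refl (<-≤-trans l' (≤-trans v (≤-reflexive (sym lo-r)))))))

    missed : ∀ {r c} → (r < a ⊎ a + ks < r) → (r , c) ∉ᶜ cellsOf Ls
    missed {r} {c} o = ¬true⇒false (λ ib → let (u , v , _) = inBox-elim {a} {lo a} {a + ks} {lo a} {r} {c} ib in
      [ (λ lt → <-irrefl refl (<-≤-trans lt u)) , (λ lt → <-irrefl refl (<-≤-trans lt v)) ] o)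

    south-leftover : ∀ {lo' hi'} →
      (∀ r → a ≤ r → r ≤ a + ks → lo r ≡ lo a × SameRow (suc (lo r)) (hi r) (lo' r) (hi' r)) →
      (∀ r → (r < a ⊎ a + ks < r) → SameRow (lo r) (hi r) (lo' r) (hi' r)) →
      (R ∖ cellsOf Ls) ≐ Reg lo' hi'
    south-leftover {lo'} {hi'} column outside (r , c) with a ≤? r | r ≤? a + ks
    ... | yes ar | yes rk = south-leftover-column {lo'} {hi'} ar rk (proj₁ (column r ar rk)) (proj₂ (column r ar rk))
    ... | no nar | _ = leftover-untouched {Ls} {lo'} {hi'} (missed (inj₁ (≰⇒> nar))) (outside r (inj₁ (≰⇒> nar)))
    ... | yes ar | no nrk = leftover-untouched {Ls} {lo'} {hi'} (missed (inj₂ (≰⇒> nrk))) (outside r (inj₂ (≰⇒> nrk)))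

-- CutRect a b m n ne sw se is the
-- rectangle of rows a … a + m and columns b … b + n, minus its NE, SW and
-- SE corner squares according to the three flags.  It is a row-interval
-- region whose row r has one of five shapes ('RowKind'): outside the
-- rectangle, top row, middle row, bottom row, or the only row.

data RowKind : Set where
  out top mid last single : RowKind

-- kind of relative row i + 1 of a rectangle with rows 0 … m
lowerKind : ℕ → ℕ → RowKind
lowerKind i zero = out
lowerKind zero (suc zero) = last
lowerKind zero (suc (suc m)) = mid
lowerKind (suc i) (suc m) = lowerKind i m

relKind : ℕ → ℕ → RowKind
relKind zero zero = single
relKind zero (suc m) = top
relKind (suc i) m = lowerKind i m

rowKind : ℕ → ℕ → ℕ → RowKind
rowKind zero m r = relKind r m
rowKind (suc a) m zero = out
rowKind (suc a) m (suc r) = rowKind a m r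

-- moving an end of an interval inwards when a corner is cut
inc dec : Bool → ℕ → ℕ
inc true k = suc k
inc false k = k
dec true k = pred k
dec false k = k

inc-≥ : ∀ x k → k ≤ inc x k
inc-≥ true k = n≤1+n k
inc-≥ false k = ≤-refl

dec-≤ : ∀ x k → dec x k ≤ k
dec-≤ true zero = z≤n
dec-≤ true (suc k) = n≤1+n k
dec-≤ false k = ≤-refl

kindLo : RowKind → ℕ → Bool → ℕ
kindLo out b sw = b
kindLo top b sw = b
kindLo mid b sw = b
kindLo last b sw = inc sw b
kindLo single b sw = inc sw b

kindHi : RowKind → ℕ → ℕ → Bool → Bool → ℕ
kindHi out b n ne se = 0
kindHi top b n ne se = dec ne (suc (b + n))
kindHi mid b n ne se = suc (b + n)
kindHi last b n ne se = dec se (suc (b + n))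
kindHi single b n ne se = dec ne (dec se (suc (b + n)))

cutLo cutHi : ℕ → ℕ → ℕ → ℕ → Bool → Bool → Bool → ℕ → ℕ
cutLo a b m n ne sw se r = kindLo (rowKind a m r) b sw
cutHi a b m n ne sw se r = kindHi (rowKind a m r) b n ne se

CutRect : ℕ → ℕ → ℕ → ℕ → Bool → Bool → Bool → CellSet
CutRect a b m n ne sw se = Reg (cutLo a b m n ne sw se) (cutHi a b m n ne sw se)

≤⇒+ : ∀ {a r} → a ≤ r → Σ ℕ λ i → r ≡ a + i
≤⇒+ {a} {r} le = (r ∸ a) , sym (m+[n∸m]≡n le)

rowKind-above : ∀ a m r → r < a → rowKind a m r ≡ out
rowKind-above (suc a) m zero _ = refl
rowKind-above (suc a) m (suc r) (s≤s lt) = rowKind-above a m r lt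

rowKind-rel : ∀ a m i → rowKind a m (a + i) ≡ relKind i m
rowKind-rel zero m i = refl
rowKind-rel (suc a) m i = rowKind-rel a m i

rowKind-top : ∀ a m → rowKind a m a ≡ relKind 0 m
rowKind-top zero m = refl
rowKind-top (suc a) m = rowKind-top a m

lowerKind-beyond : ∀ i m → m ≤ i → lowerKind i m ≡ out
lowerKind-beyond i zero _ = refl
lowerKind-beyond (suc i) (suc m) (s≤s le) = lowerKind-beyond i m le

lowerKind-last : ∀ i → lowerKind i (suc i) ≡ last
lowerKind-last zero = refl
lowerKind-last (suc i) = lowerKind-last i

lowerKind-mid : ∀ i m → suc (suc i) ≤ m → lowerKind i m ≡ mid
lowerKind-mid zero (suc (suc m)) _ = refl
lowerKind-mid zero (suc zero) (s≤s ())
lowerKind-mid (suc i) (suc m) (s≤s le) = lowerKind-mid i m le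

rowKind-below : ∀ a m r → a + m < r → rowKind a m r ≡ out
rowKind-below a m r lt with ≤⇒+ {a} {r} (≤-trans (m≤m+n a m) (<⇒≤ lt))
... | (i , refl) rewrite rowKind-rel a m i =
  below i m (+-cancelˡ-≤ a _ _ (subst (_≤ a + i) (sym (+-suc a m)) lt))
  where
  below : ∀ i m → m < i → relKind i m ≡ out
  below (suc j) m (s≤s le) = lowerKind-beyond j m le

rowKind-single : ∀ a r → ¬ (r ≡ a) → rowKind a 0 r ≡ out
rowKind-single a r ne with <-cmp r a
... | tri< lt _ _ = rowKind-above a 0 r lt
... | tri≈ _ e _ = ⊥-elim (ne e)
... | tri> _ _ gt = rowKind-below a 0 r (subst (_< r) (sym (+-identityʳ a)) gt)

-- Removing the top row of a rectangle with at least two rows: the other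
-- rows keep their intervals (a row becoming the new top row does not
-- lose its NE square, since the NE flag is dropped).

data DropTop : RowKind → RowKind → Set where
  mid→top : DropTop mid top
  last→single : DropTop last single
  out→out : DropTop out out
  mid→mid : DropTop mid mid
  last→last : DropTop last last

lowerKind-same : ∀ i m → DropTop (lowerKind i m) (lowerKind i m)
lowerKind-same i zero = out→out
lowerKind-same zero (suc zero) = last→last
lowerKind-same zero (suc (suc m)) = mid→mid
lowerKind-same (suc i) (suc m) = lowerKind-same i m

lowerKind-dropTop : ∀ i m → DropTop (lowerKind i (suc m)) (relKind i m)
lowerKind-dropTop zero zero = last→single
lowerKind-dropTop zero (suc m) = mid→top
lowerKind-dropTop (suc i) m = lowerKind-same i m

rowKind-dropTop : ∀ a m r → ¬ (r ≡ a) → DropTop (rowKind a (suc m) r) (rowKind (suc a) m r)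
rowKind-dropTop zero m zero ne = ⊥-elim (ne refl)
rowKind-dropTop zero m (suc r) ne = lowerKind-dropTop r m
rowKind-dropTop (suc a) m zero ne = out→out
rowKind-dropTop (suc a) m (suc r) ne = rowKind-dropTop a m r (λ e → ne (cong suc e))

DropTop-sameRow : ∀ {k k'} b n ne sw se → DropTop k k' →
                  SameRow (kindLo k b sw) (kindHi k b n ne se) (kindLo k' b sw) (kindHi k' b n false se)
DropTop-sameRow b n ne sw se mid→top = inj₁ (refl , refl)
DropTop-sameRow b n ne sw se last→single = inj₁ (refl , refl)
DropTop-sameRow b n ne sw se out→out = inj₁ (refl , refl)
DropTop-sameRow b n ne sw se mid→mid = inj₁ (refl , refl)
DropTop-sameRow b n ne sw se last→last = inj₁ (refl , refl)

dropTop-sameRow : ∀ a b m n ne sw se r → ¬ (r ≡ a) →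
  SameRow (cutLo a b (suc m) n ne sw se r) (cutHi a b (suc m) n ne sw se r)
          (cutLo (suc a) b m n false sw se r) (cutHi (suc a) b m n false sw se r)
dropTop-sameRow a b m n ne sw se r r≢a = DropTop-sameRow b n ne sw se (rowKind-dropTop a m r r≢a)

kindHi-shift : ∀ k b n ne se → kindHi k (suc b) n ne se ≡ kindHi k b (suc n) ne se
kindHi-shift out b n ne se = refl
kindHi-shift top b n ne se = cong (λ x → dec ne (suc x)) (sym (+-suc b n))
kindHi-shift mid b n ne se = cong suc (sym (+-suc b n))
kindHi-shift last b n ne se = cong (λ x → dec se (suc x)) (sym (+-suc b n))
kindHi-shift single b n ne se = cong (λ x → dec ne (dec se (suc x))) (sym (+-suc b n))

-- The south spotlight at the corner runs down
-- the first column through dec cut (suc m) rows below the top, where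
-- 'cut' says whether the bottom square of that column is missing; along
-- it the rows are of kind ColumnRow, below it of kind BelowColumn.

data ColumnRow (cut : Bool) : RowKind → Set where
  top-row : ColumnRow cut top
  mid-row : ColumnRow cut mid
  last-row : cut ≡ false → ColumnRow cut last

columnRow : ∀ m cut i → i ≤ dec cut (suc m) → ColumnRow cut (relKind i (suc m))
columnRow m cut zero _ = top-row
columnRow m cut (suc j) le with <-cmp j m
... | tri< lt _ _ = subst (ColumnRow cut) (sym (lowerKind-mid j (suc m) (s≤s lt))) mid-row
... | tri≈ _ refl _ = subst (ColumnRow cut) (sym (lowerKind-last j)) (last-row (uncut cut le))
  where
  uncut : ∀ x → suc j ≤ dec x (suc j) → x ≡ false
  uncut true le = ⊥-elim (1+n≰n le)
  uncut false _ = refl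
... | tri> _ _ gt = ⊥-elim (1+n≰n (≤-trans (s≤s gt) (≤-trans le (dec-≤ cut (suc m)))))

data BelowColumn (cut : Bool) : RowKind → Set where
  out-row : BelowColumn cut out
  cut-row : cut ≡ true → BelowColumn cut last

belowColumn : ∀ m cut i → dec cut (suc m) < i → BelowColumn cut (relKind i (suc m))
belowColumn m cut (suc j) (s≤s le) with <-cmp j m
... | tri< lt _ _ = ⊥-elim (1+n≰n (≤-trans lt (≤-trans (m≤dec cut) le)))
  where
  m≤dec : ∀ x → m ≤ dec x (suc m)
  m≤dec true = ≤-refl
  m≤dec false = n≤1+n m
... | tri≈ _ refl _ = subst (BelowColumn cut) (sym (lowerKind-last j)) (cut-row (is-cut cut le))
  where
  is-cut : ∀ x → dec x (suc j) ≤ j → x ≡ true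
  is-cut true _ = refl
  is-cut false le = ⊥-elim (1+n≰n le)
... | tri> _ _ gt = subst (BelowColumn cut) (sym (lowerKind-beyond j (suc m) gt)) out-row

along-column : ∀ a m cut i → i ≤ dec cut (suc m) → ColumnRow cut (rowKind a (suc m) (a + i))
along-column a m cut i le = subst (ColumnRow cut) (sym (rowKind-rel a (suc m) i)) (columnRow m cut i le)

below-column : ∀ a m cut r → a + dec cut (suc m) < r → BelowColumn cut (rowKind a (suc m) r)
below-column a m cut r gt with ≤⇒+ {a} {r} (≤-trans (m≤m+n a _) (<⇒≤ gt))
... | (i , refl) = subst (BelowColumn cut) (sym (rowKind-rel a (suc m) i))
                     (belowColumn m cut i (+-cancelˡ-≤ a _ _ (subst (_≤ a + i) (sym (+-suc a _)) gt)))

-- The cut rectangle is a staircase region (hence has a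
-- unique northwest corner and is connected) provided: cutting NE needs at
-- least two rows and two columns; the 2 × 2 square minus NE and SW (two
-- diagonal squares) is excluded; cutting SW from several rows needs two
-- columns.  For a single row, RowRoom asks that some square remains.

record Valid (m n : ℕ) (ne sw se : Bool) : Set where
  field
    ne-room : ne ≡ true → 1 ≤ m × 1 ≤ n
    not-diagonal : m ≡ 1 → n ≡ 1 → ne ≡ true → sw ≡ true → ⊥
    sw-room : sw ≡ true → m ≡ 0 ⊎ 1 ≤ n

rowRemoved : Bool → Bool → ℕ
rowRemoved sw se = inc sw (inc se 0)

RowRoom : ℕ → ℕ → Bool → Bool → Set
RowRoom m n sw se = m ≡ 0 → rowRemoved sw se ≤ n

k+b≤b+n : ∀ b k {n} → k ≤ n → k + b ≤ b + n
k+b≤b+n b k {n} h = subst (_≤ b + n) (+-comm b k) (+-monoʳ-≤ b h)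

cut-above-empty : ∀ a b m n ne sw se r → r < a → cutHi a b m n ne sw se r ≤ cutLo a b m n ne sw se r
cut-above-empty a b m n ne sw se r lt rewrite rowKind-above a m r lt = z≤n

cut-top-nonempty : ∀ a b m n ne sw se → Valid m n ne sw se → RowRoom m n sw se →
                   cutLo a b m n ne sw se a < cutHi a b m n ne sw se a
cut-top-nonempty a b m n ne sw se v room rewrite rowKind-top a m = top-row-nonempty m ne sw se (Valid.ne-room v) room
  where
  top-row-nonempty : ∀ m ne sw se → (ne ≡ true → 1 ≤ m × 1 ≤ n) → RowRoom m n sw se →
        kindLo (relKind 0 m) b sw < kindHi (relKind 0 m) b n ne se
  top-row-nonempty zero true sw se h room with proj₁ (h refl)
  ... | ()
  top-row-nonempty zero false false false h room = s≤s (m≤m+n b n)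
  top-row-nonempty zero false true false h room = s≤s (k+b≤b+n b 1 (room refl))
  top-row-nonempty zero false false true h room = k+b≤b+n b 1 (room refl)
  top-row-nonempty zero false true true h room = k+b≤b+n b 2 (room refl)
  top-row-nonempty (suc m) false sw se h room = s≤s (m≤m+n b n)
  top-row-nonempty (suc m) true sw se h room = k+b≤b+n b 1 (proj₂ (h refl))

data LowerPair : RowKind → RowKind → Set where
  any→out : ∀ {k} → LowerPair k out
  mid→mid : LowerPair mid mid
  mid→last : LowerPair mid last

lowerPair : ∀ j m → LowerPair (lowerKind j m) (lowerKind (suc j) m)
lowerPair j zero = any→out
lowerPair zero (suc zero) = any→out
lowerPair zero (suc (suc zero)) = mid→last
lowerPair zero (suc (suc (suc m))) = mid→mid
lowerPair (suc j) (suc m) = lowerPair j m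

lowerPair-steps : ∀ {k k'} b n ne sw se → LowerPair k k' → kindLo k' b sw < kindHi k' b n ne se →
                  kindLo k b sw ≤ kindLo k' b sw × kindLo k' b sw < kindHi k b n ne se
lowerPair-steps b n ne sw se any→out ()
lowerPair-steps b n ne sw se mid→mid _ = ≤-refl , s≤s (m≤m+n b n)
lowerPair-steps b n ne sw se mid→last nonempty = inc-≥ sw b , ≤-trans nonempty (dec-≤ se _)

cut-steps : ∀ a b m n ne sw se → Valid m n ne sw se → ∀ r → a ≤ r →
  cutLo a b m n ne sw se (suc r) < cutHi a b m n ne sw se (suc r) →
  cutLo a b m n ne sw se r ≤ cutLo a b m n ne sw se (suc r) × cutLo a b m n ne sw se (suc r) < cutHi a b m n ne sw se r
cut-steps a b m n ne sw se v r le with ≤⇒+ le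
... | (i , refl) rewrite sym (+-suc a i) | rowKind-rel a m i | rowKind-rel a m (suc i) =
  steps i m ne sw (Valid.ne-room v) (Valid.not-diagonal v)
  where
  steps : ∀ i m ne sw → (ne ≡ true → 1 ≤ m × 1 ≤ n) → (m ≡ 1 → n ≡ 1 → ne ≡ true → sw ≡ true → ⊥) →
          kindLo (lowerKind i m) b sw < kindHi (lowerKind i m) b n ne se →
          kindLo (relKind i m) b sw ≤ kindLo (lowerKind i m) b sw × kindLo (lowerKind i m) b sw < kindHi (relKind i m) b n ne se
  steps (suc j) m ne sw _ _ nonempty = lowerPair-steps b n ne sw se (lowerPair j m) nonempty
  steps zero zero ne sw _ _ ()
  steps zero (suc zero) false sw' _ _ nonempty = inc-≥ sw' b , ≤-trans nonempty (dec-≤ se _)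
  steps zero (suc zero) true false h _ _ = ≤-refl , k+b≤b+n b 1 (proj₂ (h refl))
  steps zero (suc zero) true true h diag _ = n≤1+n b , k+b≤b+n b 2 (two (proj₂ (h refl)) (λ n1 → diag refl n1 refl refl))
    where
    two : ∀ {n} → 1 ≤ n → ¬ (n ≡ 1) → 2 ≤ n
    two {suc zero} _ h = ⊥-elim (h refl)
    two {suc (suc n)} _ _ = s≤s (s≤s z≤n)
  steps zero (suc (suc m')) false sw _ _ _ = ≤-refl , s≤s (m≤m+n b n)
  steps zero (suc (suc m')) true sw h _ _ = ≤-refl , k+b≤b+n b 1 (proj₂ (h refl))

module CutStaircase (a b m n : ℕ) (ne sw se : Bool) (v : Valid m n ne sw se) (room : RowRoom m n sw se) =
  Staircase (cutLo a b m n ne sw se) (cutHi a b m n ne sw se) a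
    (cut-above-empty a b m n ne sw se) (cut-top-nonempty a b m n ne sw se v room) (cut-steps a b m n ne sw se v)

-- The tiling numbers.  count m n ne sw se is the number of tilings of an
-- admissible cut rectangle with m + 1 rows and n + 1 columns; it is
-- defined by the recursion at the northwest corner (east spotlight: the
-- top row goes; south spotlight: the first column goes).

-- a row of ℓ squares has ℓ tilings when ℓ ≥ 1, the empty row one
rowCount : ℕ → Bool → Bool → ℕ
rowCount n sw se = suc (n ∸ rowRemoved sw se)

-- a column of m + 2 squares (the last one possibly cut): the east
-- spotlight takes the top square, the south spotlight the whole column
columnCount : ℕ → Bool → ℕ
columnCount zero true = 1
columnCount zero false = 2
columnCount (suc m) se = columnCount m se + 1

mutual
  count : ℕ → ℕ → Bool → Bool → Bool → ℕ
  count zero n ne sw se = rowCount n sw se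
  count (suc m) zero ne sw se = columnCount m se
  count (suc m) (suc n) ne sw se = count m (suc n) false sw se + southCount m n ne se

  -- tilings of the leftover of the south spotlight: the rectangle one
  -- column narrower, or a column without its top square when only the
  -- column below a cut NE corner remains
  southCount : ℕ → ℕ → Bool → Bool → ℕ
  southCount m zero true se = count m zero false false se
  southCount m zero false se = count (suc m) zero false false se
  southCount m (suc n) ne se = count (suc m) (suc n) ne false se

m+k≡m⇒k≡0 : ∀ c k → c + k ≡ c → k ≡ 0
m+k≡m⇒k≡0 c k e = +-cancelˡ-≡ c k 0 (trans e (sym (+-identityʳ c)))

b+n∸[k+b]≡n∸k : ∀ b n k → b + n ∸ (k + b) ≡ n ∸ k
b+n∸[k+b]≡n∸k b n k = trans (cong (b + n ∸_) (+-comm k b)) ([m+n]∸[m+o]≡n∸o b n k)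

single-row-length : ∀ b n sw se → dec false (dec se (suc (b + n))) ∸ suc (inc sw b) ≡ n ∸ rowRemoved sw se
single-row-length b n false false = b+n∸[k+b]≡n∸k b n 0
single-row-length b n true false = b+n∸[k+b]≡n∸k b n 1
single-row-length b n false true = b+n∸[k+b]≡n∸k b n 1
single-row-length b n true true = b+n∸[k+b]≡n∸k b n 2

single-row-empty : ∀ b n sw se → ¬ (rowRemoved sw se ≤ n) → dec false (dec se (suc (b + n))) ≤ inc sw b
single-row-empty b n false false h = ⊥-elim (h z≤n)
single-row-empty b zero true false h = s≤s (≤-reflexive (+-identityʳ b))
single-row-empty b (suc n) true false h = ⊥-elim (h (s≤s z≤n))
single-row-empty b zero false true h = ≤-reflexive (+-identityʳ b)
single-row-empty b (suc n) false true h = ⊥-elim (h (s≤s z≤n))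
single-row-empty b zero true true h = ≤-trans (≤-reflexive (+-identityʳ b)) (n≤1+n b)
single-row-empty b (suc zero) true true h = ≤-reflexive (+-comm b 1)
single-row-empty b (suc (suc n)) true true h = ⊥-elim (h (s≤s (s≤s z≤n)))

inc-suc : ∀ sw b → suc (inc sw b) ≡ inc sw (suc b)
inc-suc true b = refl
inc-suc false b = refl

Zero : ℕ → ℕ
Zero _ = 0

ends-equal : ∀ {p q q' : Cell} → (p , q) ≡ (p , q') → q ≡ q'
ends-equal refl = refl

-- A single row.  The east spotlight covers the row; the south spotlight
-- is the corner square alone, leaving the row shifted one column right.

module RowCase (n : ℕ) (sw se : Bool) (a b : ℕ) (v : Valid 0 n false sw se) (room : RowRoom 0 n sw se) where
  open CutStaircase a b 0 n false sw se v room hiding (Le) public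
  lo = cutLo a b 0 n false sw se
  hi = cutHi a b 0 n false sw se

  ke-val : ke ≡ n ∸ rowRemoved sw se
  ke-val rewrite rowKind-top a 0 = single-row-length b n sw se

  other-rows-empty : ∀ r → ¬ (r ≡ a) → hi r ≡ 0
  other-rows-empty r r≢a rewrite rowKind-single a r r≢a = refl

  south-in : ∀ i → i ≤ 0 → (a + i , lo a) ∈ᶜ R
  south-in zero _ = subst (λ r → (r , lo a) ∈ᶜ R) (sym (+-identityʳ a)) p∈R

  south-stop : (a + 1 , lo a) ∉ᶜ R
  south-stop = Reg-out {lo} {hi} (λ _ q → n≮0 (≤-trans q (≤-reflexive
    (other-rows-empty (a + 1) (λ e → 1+n≰n (≤-reflexive (trans (sym (+-comm a 1)) e)))))))

  open UniqueCornerStep R a (lo a) p-corner p-unique ke east-in east-stop 0 south-in south-stop public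

  east-count : NumTilingsᶜ (R ∖ cellsOf Le) 1
  east-count = NumTilingsᶜ-resp
    (≐-sym (east-leftover {Zero} {Zero} z≤n (λ r r≢a → inj₂ (≤-trans (≤-reflexive (other-rows-empty r r≢a)) z≤n , z≤n))))
    (empty-count (Reg-empty {Zero} {Zero} (λ _ → z≤n)))

row-one-square : ∀ n sw se a b (v : Valid 0 n false sw se) (room : RowRoom 0 n sw se) → rowRemoved sw se ≡ n →
  NumTilings (CutRect a b 0 n false sw se) (count 0 n false sw se)
row-one-square n sw se a b v room removed≡n =
  subst (NumTilings R) (sym (cong suc no-more)) (count-same same east-count)
  where
  open RowCase n sw se a b v room
  no-more : n ∸ rowRemoved sw se ≡ 0
  no-more = subst (λ k → n ∸ k ≡ 0) (sym removed≡n) (n∸n≡0 n)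
  same : Le ≡ Ls
  same = cong₂ (λ x y → ((a , lo a) , (x , y))) (sym (+-identityʳ a))
               (trans (cong (lo a +_) (trans ke-val no-more)) (+-identityʳ (lo a)))

row-step : ∀ n sw se a b (v : Valid 0 (suc n) false sw se) (room : RowRoom 0 (suc n) sw se) → rowRemoved sw se ≤ n →
  NumTilingsᶜ (CutRect a (suc b) 0 n false sw se) (count 0 n false sw se) →
  NumTilings (CutRect a b 0 (suc n) false sw se) (count 0 (suc n) false sw se)
row-step n sw se a b v room le rest =
  subst (NumTilings R) (sym (cong suc (+-∸-assoc 1 le))) (count-diff diff east-count south-count)
  where
  open RowCase (suc n) sw se a b v room
  open SouthSpotlight 0 hiding (Ls)
  diff : ¬ (Le ≡ Ls)
  diff e with trans (sym (trans ke-val (+-∸-assoc 1 le))) (m+k≡m⇒k≡0 (lo a) ke (cong proj₂ (ends-equal e)))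
  ... | ()
  lo' = cutLo a (suc b) 0 n false sw se
  hi' = cutHi a (suc b) 0 n false sw se
  column : ∀ r → a ≤ r → r ≤ a + 0 → lo r ≡ lo a × SameRow (suc (lo r)) (hi r) (lo' r) (hi' r)
  column r ar rk with ≤-antisym (≤-trans rk (≤-reflexive (+-identityʳ a))) ar
  ... | refl rewrite rowKind-top r 0 = refl , inj₁ (inc-suc sw b , sym (kindHi-shift single b n false se))
  outside : ∀ r → (r < a ⊎ a + 0 < r) → SameRow (lo r) (hi r) (lo' r) (hi' r)
  outside r (inj₁ lt) rewrite rowKind-above a 0 r lt = inj₂ (z≤n , z≤n)
  outside r (inj₂ gt) rewrite rowKind-below a 0 r gt = inj₂ (z≤n , z≤n)
  south-count : NumTilingsᶜ (R ∖ cellsOf Ls) (count 0 n false sw se)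
  south-count = NumTilingsᶜ-resp (≐-sym (south-leftover {lo'} {hi'} column outside)) rest

-- The
-- east spotlight is the corner square, leaving the column below it; the
-- south spotlight is the whole column, leaving nothing.

interval-in : ∀ {l h c} → l ≤ c → c < h → ((l ≤ᵇ c) ∧ (c <ᵇ h)) ≡ true
interval-in {l} {h} {c} p q = Reg-intro {λ _ → l} {λ _ → h} {0} {c} p q

interval-out : ∀ {l h c} → (l ≤ c → c < h → ⊥) → ((l ≤ᵇ c) ∧ (c <ᵇ h)) ≡ false
interval-out {l} {h} {c} f = Reg-out {λ _ → l} {λ _ → h} {0} {c} f

module ColumnCase (m : ℕ) (se : Bool) (a b : ℕ)
  (v : Valid (suc m) 0 false false se) (room : RowRoom (suc m) 0 false se) where
  open CutStaircase a b (suc m) 0 false false se v room hiding (Le) public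
  lo = cutLo a b (suc m) 0 false false se
  hi = cutHi a b (suc m) 0 false false se

  lo-top : lo a ≡ b
  lo-top rewrite rowKind-top a (suc m) = refl

  ke-zero : ke ≡ 0
  ke-zero rewrite rowKind-top a (suc m) = m+n∸m≡n b 0

  ks = dec se (suc m)

  along : ∀ {k} → ColumnRow se k → ((kindLo k b false ≤ᵇ b) ∧ (b <ᵇ kindHi k b 0 false se)) ≡ true
  along top-row = interval-in {b} {suc (b + 0)} ≤-refl (s≤s (m≤m+n b 0))
  along mid-row = interval-in {b} {suc (b + 0)} ≤-refl (s≤s (m≤m+n b 0))
  along (last-row refl) = interval-in {b} {suc (b + 0)} ≤-refl (s≤s (m≤m+n b 0))

  below : ∀ {k} → BelowColumn se k → ((kindLo k b false ≤ᵇ b) ∧ (b <ᵇ kindHi k b 0 false se)) ≡ false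
  below out-row = interval-out {b} {0} (λ _ ())
  below (cut-row refl) = interval-out {b} {b + 0} (λ _ q → 1+n≰n (≤-trans q (≤-reflexive (+-identityʳ b))))

  south-in : ∀ i → i ≤ ks → (a + i , lo a) ∈ᶜ R
  south-in i le = subst (λ c → (a + i , c) ∈ᶜ R) (sym lo-top) (along (along-column a m se i le))

  south-stop : (a + suc ks , lo a) ∉ᶜ R
  south-stop = subst (λ c → (a + suc ks , c) ∉ᶜ R) (sym lo-top)
                 (below (below-column a m se (a + suc ks) (≤-reflexive (sym (+-suc a ks)))))

  open UniqueCornerStep R a (lo a) p-corner p-unique ke east-in east-stop ks south-in south-stop public

  east-count : ∀ {c} → NumTilingsᶜ (CutRect (suc a) b m 0 false false se) c → NumTilingsᶜ (R ∖ cellsOf Le) c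
  east-count = NumTilingsᶜ-resp (≐-sym (east-leftover {cutLo (suc a) b m 0 false false se} {cutHi (suc a) b m 0 false false se}
                 (subst (λ k → kindHi k b 0 false se ≤ kindLo k b false) (sym (rowKind-above (suc a) m a (n<1+n a))) z≤n)
                 (dropTop-sameRow a b m 0 false false se)))

column-one-square : ∀ a b (v : Valid 1 0 false false true) (room : RowRoom 1 0 false true) →
  NumTilingsᶜ (CutRect (suc a) b 0 0 false false true) 1 → NumTilings (CutRect a b 1 0 false false true) 1
column-one-square a b v room rest = count-same same (east-count rest)
  where
  open ColumnCase 0 true a b v room
  same : Le ≡ Ls
  same = cong₂ (λ x y → ((a , lo a) , (x , y))) (sym (+-identityʳ a))
               (trans (cong (lo a +_) ke-zero) (+-identityʳ (lo a)))

column-step : ∀ m se a b (v : Valid (suc m) 0 false false se) (room : RowRoom (suc m) 0 false se) →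
  ∀ {c k} → dec se (suc m) ≡ suc k →
  NumTilingsᶜ (CutRect (suc a) b m 0 false false se) c → NumTilings (CutRect a b (suc m) 0 false false se) (c + 1)
column-step m se a b v room {c} {k} ks≡suc rest = count-diff diff (east-count rest) south-count
  where
  open ColumnCase m se a b v room
  open SouthSpotlight ks hiding (Ls)
  diff : ¬ (Le ≡ Ls)
  diff e with trans (sym ks≡suc) (m+k≡m⇒k≡0 a ks (sym (cong proj₁ (ends-equal e))))
  ... | ()
  along-empty : ∀ {k} → ColumnRow se k → kindHi k b 0 false se ≤ suc (kindLo k b false) × kindLo k b false ≡ b
  along-empty top-row = s≤s (≤-reflexive (+-identityʳ b)) , refl
  along-empty mid-row = s≤s (≤-reflexive (+-identityʳ b)) , refl
  along-empty (last-row refl) = s≤s (≤-reflexive (+-identityʳ b)) , refl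
  column : ∀ r → a ≤ r → r ≤ a + ks → lo r ≡ lo a × SameRow (suc (lo r)) (hi r) (Zero r) (Zero r)
  column r ar rk with ≤⇒+ ar
  ... | (i , refl) with along-empty (along-column a m se i (+-cancelˡ-≤ a _ _ rk))
  ... | (h1 , h2) = trans h2 (sym lo-top) , inj₂ (h1 , z≤n)
  below-empty : ∀ {k} → BelowColumn se k → kindHi k b 0 false se ≤ kindLo k b false
  below-empty out-row = z≤n
  below-empty (cut-row refl) = ≤-reflexive (+-identityʳ b)
  outside : ∀ r → (r < a ⊎ a + ks < r) → SameRow (lo r) (hi r) (Zero r) (Zero r)
  outside r (inj₁ lt) rewrite rowKind-above a (suc m) r lt = inj₂ (z≤n , z≤n)
  outside r (inj₂ gt) = inj₂ (below-empty (below-column a m se r gt) , z≤n)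
  south-count : NumTilingsᶜ (R ∖ cellsOf Ls) 1
  south-count = NumTilingsᶜ-resp (≐-sym (south-leftover {Zero} {Zero} column outside))
                  (empty-count (Reg-empty {Zero} {Zero} (λ _ → z≤n)))

-- The east spotlight removes the top
-- row, leaving the rectangle one row shorter (NE no longer cut); the
-- south spotlight removes the first column, leaving the rectangle one
-- column narrower (SW no longer cut).

top-row-end : ∀ x b n → b < dec x (suc (b + suc n))
top-row-end false b n = s≤s (m≤m+n b (suc n))
top-row-end true b n = k+b≤b+n b 1 (s≤s z≤n)

top-row-length : ∀ x b n → dec x (suc (b + suc n)) ∸ suc b ≡ dec x (suc n)
top-row-length false b n = m+n∸m≡n b (suc n)
top-row-length true b n = b+n∸[k+b]≡n∸k b (suc n) 1

dec-suc≡0 : ∀ x k → dec x (suc k) ≡ 0 → x ≡ true × k ≡ 0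
dec-suc≡0 true zero _ = refl , refl

module GeneralCase (m n : ℕ) (ne sw se : Bool) (a b : ℕ)
  (v : Valid (suc m) (suc n) ne sw se) (room : RowRoom (suc m) (suc n) sw se) where
  open CutStaircase a b (suc m) (suc n) ne sw se v room hiding (Le) public
  lo = cutLo a b (suc m) (suc n) ne sw se
  hi = cutHi a b (suc m) (suc n) ne sw se

  lo-top : lo a ≡ b
  lo-top rewrite rowKind-top a (suc m) = refl

  ks = dec sw (suc m)

  along : ∀ {k} → ColumnRow sw k → ((kindLo k b sw ≤ᵇ b) ∧ (b <ᵇ kindHi k b (suc n) ne se)) ≡ true
  along top-row = interval-in {b} {_} {b} ≤-refl (top-row-end ne b n)
  along mid-row = interval-in {b} {_} {b} ≤-refl (s≤s (m≤m+n b (suc n)))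
  along (last-row refl) = interval-in {b} {_} {b} ≤-refl (top-row-end se b n)

  below : ∀ {k} → BelowColumn sw k → ((kindLo k b sw ≤ᵇ b) ∧ (b <ᵇ kindHi k b (suc n) ne se)) ≡ false
  below out-row = interval-out {b} {0} (λ _ ())
  below (cut-row refl) = interval-out {suc b} {dec se (suc (b + suc n))} {b} (λ p _ → 1+n≰n p)

  south-in : ∀ i → i ≤ ks → (a + i , lo a) ∈ᶜ R
  south-in i le = subst (λ c → (a + i , c) ∈ᶜ R) (sym lo-top) (along (along-column a m sw i le))

  south-stop : (a + suc ks , lo a) ∉ᶜ R
  south-stop = subst (λ c → (a + suc ks , c) ∉ᶜ R) (sym lo-top)
                 (below (below-column a m sw (a + suc ks) (≤-reflexive (sym (+-suc a ks)))))

  open UniqueCornerStep R a (lo a) p-corner p-unique ke east-in east-stop ks south-in south-stop public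
  open SouthSpotlight ks public hiding (Ls)

  east-count : ∀ {c} → NumTilingsᶜ (CutRect (suc a) b m (suc n) false sw se) c → NumTilingsᶜ (R ∖ cellsOf Le) c
  east-count = NumTilingsᶜ-resp (≐-sym (east-leftover {cutLo (suc a) b m (suc n) false sw se} {cutHi (suc a) b m (suc n) false sw se}
                 (subst (λ k → kindHi k b (suc n) false se ≤ kindLo k b sw) (sym (rowKind-above (suc a) m a (n<1+n a))) z≤n)
                 (dropTop-sameRow a b m (suc n) ne sw se)))

  ke-val : ke ≡ dec ne (suc n)
  ke-val rewrite rowKind-top a (suc m) = top-row-length ne b n

  -- the two spotlights agree only for the excluded diagonal 2 × 2 shape
  diff : ¬ (Le ≡ Ls)
  diff e with dec-suc≡0 ne n (trans (sym ke-val) (m+k≡m⇒k≡0 (lo a) ke (cong proj₂ (ends-equal e))))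
            | dec-suc≡0 sw m (m+k≡m⇒k≡0 a ks (sym (cong proj₁ (ends-equal e))))
  ... | (e1 , e2) | (e3 , e4) = Valid.not-diagonal v (cong suc e4) (cong suc e2) e1 e3

  lo' = cutLo a (suc b) (suc m) n ne false se
  hi' = cutHi a (suc b) (suc m) n ne false se

  along-shift : ∀ {k} → ColumnRow sw k →
    kindLo k b sw ≡ b × SameRow (suc (kindLo k b sw)) (kindHi k b (suc n) ne se) (kindLo k (suc b) false) (kindHi k (suc b) n ne se)
  along-shift {k} top-row = refl , inj₁ (refl , sym (kindHi-shift k b n ne se))
  along-shift {k} mid-row = refl , inj₁ (refl , sym (kindHi-shift k b n ne se))
  along-shift {k} (last-row refl) = refl , inj₁ (refl , sym (kindHi-shift k b n ne se))

  below-shift : ∀ {k} → BelowColumn sw k →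
    SameRow (kindLo k b sw) (kindHi k b (suc n) ne se) (kindLo k (suc b) false) (kindHi k (suc b) n ne se)
  below-shift out-row = inj₂ (z≤n , z≤n)
  below-shift {k} (cut-row refl) = inj₁ (refl , sym (kindHi-shift k b n ne se))

  column : ∀ r → a ≤ r → r ≤ a + ks → lo r ≡ lo a × SameRow (suc (lo r)) (hi r) (lo' r) (hi' r)
  column r ar rk with ≤⇒+ ar
  ... | (i , refl) with along-shift (along-column a m sw i (+-cancelˡ-≤ a _ _ rk))
  ... | (h1 , h2) = trans h1 (sym lo-top) , h2

  outside : ∀ r → (r < a ⊎ a + ks < r) → SameRow (lo r) (hi r) (lo' r) (hi' r)
  outside r (inj₁ lt) rewrite rowKind-above a (suc m) r lt = inj₂ (z≤n , z≤n)
  outside r (inj₂ gt) = below-shift (below-column a m sw r gt)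

  south-leftover-cut : (R ∖ cellsOf Ls) ≐ CutRect a (suc b) (suc m) n ne false se
  south-leftover-cut = south-leftover {lo'} {hi'} column outside

column-without-top : ∀ a b m se → CutRect a b (suc m) 0 true false se ≐ CutRect (suc a) b m 0 false false se
column-without-top a b m se = Reg-cong same
  where
  same : ∀ r → SameRow (cutLo a b (suc m) 0 true false se r) (cutHi a b (suc m) 0 true false se r)
                       (cutLo (suc a) b m 0 false false se r) (cutHi (suc a) b m 0 false false se r)
  same r with r ≟ a
  ... | yes refl rewrite rowKind-top r (suc m) | rowKind-above (suc r) m r (n<1+n r) =
    inj₂ (≤-reflexive (+-identityʳ b) , z≤n)
  ... | no r≢a = dropTop-sameRow a b m 0 true false se r r≢a

general-step-NE : ∀ m sw se a b (v : Valid (suc m) 1 true sw se) (room : RowRoom (suc m) 1 sw se) →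
  ∀ {c₁ c₂} → NumTilingsᶜ (CutRect (suc a) b m 1 false sw se) c₁ →
  NumTilingsᶜ (CutRect (suc a) (suc b) m 0 false false se) c₂ →
  NumTilings (CutRect a b (suc m) 1 true sw se) (c₁ + c₂)
general-step-NE m sw se a b v room east-rest south-rest = count-diff diff (east-count east-rest)
  (NumTilingsᶜ-resp (≐-sym (≐-trans south-leftover-cut (column-without-top a (suc b) m se))) south-rest)
  where
  open GeneralCase m 0 true sw se a b v room

general-step : ∀ m n ne sw se a b (v : Valid (suc m) (suc n) ne sw se) (room : RowRoom (suc m) (suc n) sw se) →
  ∀ {c₁ c₂} → NumTilingsᶜ (CutRect (suc a) b m (suc n) false sw se) c₁ →
  NumTilingsᶜ (CutRect a (suc b) (suc m) n ne false se) c₂ →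
  NumTilings (CutRect a b (suc m) (suc n) ne sw se) (c₁ + c₂)
general-step m n ne sw se a b v room east-rest south-rest =
  count-diff diff (east-count east-rest) (NumTilingsᶜ-resp (≐-sym south-leftover-cut) south-rest)
  where
  open GeneralCase m n ne sw se a b v room

row-valid : ∀ n sw se → Valid 0 n false sw se
row-valid n sw se = record { ne-room = λ () ; not-diagonal = λ _ _ () ; sw-room = λ _ → inj₁ refl }

column-valid : ∀ m se → Valid m 0 false false se
column-valid m se = record { ne-room = λ () ; not-diagonal = λ _ _ () ; sw-room = λ () }

east-valid : ∀ m n sw se → Valid m (suc n) false sw se
east-valid m n sw se = record { ne-room = λ () ; not-diagonal = λ _ _ () ; sw-room = λ _ → inj₂ (s≤s z≤n) }

south-valid : ∀ m n ne se → Valid (suc m) (suc n) ne false se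
south-valid m n ne se = record { ne-room = λ _ → s≤s z≤n , s≤s z≤n ; not-diagonal = λ _ _ _ () ; sw-room = λ () }

dec-suc-suc : ∀ x k → dec x (suc (suc k)) ≡ suc (dec x (suc k))
dec-suc-suc true k = refl
dec-suc-suc false k = refl

≤suc∧≰⇒≡suc : ∀ {k n} → k ≤ suc n → ¬ (k ≤ n) → k ≡ suc n
≤suc∧≰⇒≡suc le nle with m≤n⇒m<n∨m≡n le
... | inj₁ (s≤s lt) = ⊥-elim (nle lt)
... | inj₂ e = e

-- A single row as the leftover of a spotlight: if some square remains it
-- is connected, otherwise it is empty and has one tiling.
row-leftover-count : ∀ n ne sw se a b → Valid 0 n ne sw se → Dec (rowRemoved sw se ≤ n) →
  (RowRoom 0 n sw se → NumTilings (CutRect a b 0 n ne sw se) (count 0 n ne sw se)) →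
  NumTilingsᶜ (CutRect a b 0 n ne sw se) (count 0 n ne sw se)
row-leftover-count n ne sw se a b v (yes le) tilings =
  connected-count (CutStaircase.connected a b zero n ne sw se v (λ _ → le))
                  (CutStaircase.p∈R a b zero n ne sw se v (λ _ → le)) (tilings (λ _ → le))
row-leftover-count n ne sw se a b v (no nle) _ =
  subst (NumTilingsᶜ _) (sym (cong suc (m≤n⇒m∸n≡0 (<⇒≤ (≰⇒> nle))))) (empty-count (Reg-empty rows-empty))
  where
  rows-empty : ∀ r → cutHi a b 0 n ne sw se r ≤ cutLo a b 0 n ne sw se r
  rows-empty r with r ≟ a
  ... | no r≢a rewrite rowKind-single a r r≢a = z≤n
  ... | yes refl rewrite rowKind-top r 0 = the-row ne (Valid.ne-room v)
    where
    the-row : ∀ ne → (ne ≡ true → 1 ≤ 0 × 1 ≤ n) → kindHi single b n ne se ≤ kindLo single b sw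
    the-row true h with proj₁ (h refl)
    ... | ()
    the-row false h = single-row-empty b n sw se nle

mutual
  cutRect-count : ∀ m n ne sw se a b → Valid m n ne sw se → RowRoom m n sw se →
                  NumTilings (CutRect a b m n ne sw se) (count m n ne sw se)
  cutRect-count zero n true sw se a b v room with proj₁ (Valid.ne-room v refl)
  ... | ()
  cutRect-count zero zero false sw se a b v room = row-one-square zero sw se a b v room (n≤0⇒n≡0 (room refl))
  cutRect-count zero (suc n) false sw se a b v room with rowRemoved sw se ≤? n
  ... | yes le = row-step n sw se a b v room le
                   (leftover-count zero n false sw se a (suc b) (row-valid n sw se))
  ... | no nle = row-one-square (suc n) sw se a b v room (≤suc∧≰⇒≡suc (room refl) nle)
  cutRect-count (suc m) zero true sw se a b v room with proj₂ (Valid.ne-room v refl)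
  ... | ()
  cutRect-count (suc m) zero false true se a b v room with Valid.sw-room v refl
  ... | inj₁ ()
  ... | inj₂ ()
  cutRect-count (suc zero) zero false false true a b v room =
    column-one-square a b v room
      (leftover-count zero zero false false true (suc a) b (column-valid 0 true))
  cutRect-count (suc zero) zero false false false a b v room =
    column-step 0 false a b v room {k = 0} refl
      (leftover-count zero zero false false false (suc a) b (column-valid 0 false))
  cutRect-count (suc (suc m)) zero false false se a b v room =
    column-step (suc m) se a b v room (dec-suc-suc se m)
      (leftover-count (suc m) zero false false se (suc a) b (column-valid (suc m) se))
  cutRect-count (suc m) (suc zero) true sw se a b v room =
    general-step-NE m sw se a b v room
      (leftover-count m 1 false sw se (suc a) b (east-valid m 0 sw se))
      (leftover-count m zero false false se (suc a) (suc b) (column-valid m se))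
  cutRect-count (suc m) (suc zero) false sw se a b v room =
    general-step m zero false sw se a b v room
      (leftover-count m 1 false sw se (suc a) b (east-valid m 0 sw se))
      (leftover-count (suc m) zero false false se a (suc b) (column-valid (suc m) se))
  cutRect-count (suc m) (suc (suc n)) ne sw se a b v room =
    general-step m (suc n) ne sw se a b v room
      (leftover-count m (suc (suc n)) false sw se (suc a) b (east-valid m (suc n) sw se))
      (leftover-count (suc m) (suc n) ne false se a (suc b) (south-valid m n ne se))

  -- as the leftover of a spotlight (nonempty cut rectangles are connected)
  leftover-count : ∀ m n ne sw se a b → Valid m n ne sw se →
                   NumTilingsᶜ (CutRect a b m n ne sw se) (count m n ne sw se)
  leftover-count (suc m) n ne sw se a b v =
    connected-count (CutStaircase.connected a b (suc m) n ne sw se v (λ ()))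
                    (CutStaircase.p∈R a b (suc m) n ne sw se v (λ ()))
                    (cutRect-count (suc m) n ne sw se a b v (λ ()))
  leftover-count zero n ne sw se a b v =
    row-leftover-count n ne sw se a b v (rowRemoved sw se ≤? n) (cutRect-count zero n ne sw se a b v)

-- the cut-off corner squares avoided by (r , c), for last row m and last
-- column n
AvoidsCut : ℕ → ℕ → Bool → Bool → Bool → ℕ → ℕ → Set
AvoidsCut m n ne sw se r c =
  (ne ≡ true → r ≡ 0 → ¬ c ≡ n) × (sw ≡ true → r ≡ m → ¬ c ≡ 0) × (se ≡ true → r ≡ m → ¬ c ≡ n)

below-dec→ : ∀ x {c n} → c < dec x (suc n) → c ≤ n × (x ≡ true → ¬ c ≡ n)
below-dec→ true {c} {n} lt = <⇒≤ lt , λ _ e → <-irrefl e lt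
below-dec→ false (s≤s le) = le , λ ()

below-dec← : ∀ x {c n} → c ≤ n → (x ≡ true → ¬ c ≡ n) → c < dec x (suc n)
below-dec← true le h = ≤∧≢⇒< le (h refl)
below-dec← false le h = s≤s le

above-inc→ : ∀ x {c} → inc x 0 ≤ c → (x ≡ true → ¬ c ≡ 0)
above-inc→ true le _ refl = 1+n≰n le

above-inc← : ∀ x {c} → (x ≡ true → ¬ c ≡ 0) → inc x 0 ≤ c
above-inc← true {zero} h = ⊥-elim (h refl refl)
above-inc← true {suc c} h = s≤s z≤n
above-inc← false h = z≤n

CutRect-elim : ∀ m n ne sw se r c → (r , c) ∈ᶜ CutRect 0 0 (suc m) n ne sw se →
               r ≤ suc m × c ≤ n × AvoidsCut (suc m) n ne sw se r c
CutRect-elim m n ne sw se zero c e with Reg-elim {cutLo 0 0 (suc m) n ne sw se} {cutHi 0 0 (suc m) n ne sw se} {0} {c} e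
... | (_ , h) = let (x , y) = below-dec→ ne h in z≤n , x , (λ q _ → y q) , (λ _ ()) , (λ _ ())
CutRect-elim m n ne sw se (suc j) c e
  with Reg-elim {cutLo 0 0 (suc m) n ne sw se} {cutHi 0 0 (suc m) n ne sw se} {suc j} {c} e | <-cmp j m
... | (l , h) | tri< lt _ _ rewrite lowerKind-mid j (suc m) (s≤s lt) =
  s≤s (<⇒≤ lt) , ≤-pred h , (λ _ ()) ,
  (λ _ e → ⊥-elim (<-irrefl (suc-injective e) lt)) , (λ _ e → ⊥-elim (<-irrefl (suc-injective e) lt))
... | (l , h) | tri≈ _ refl _ rewrite lowerKind-last j =
  let (x , y) = below-dec→ se h in ≤-refl , x , (λ _ ()) , (λ q _ → above-inc→ sw l q) , (λ q _ → y q)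
... | (l , h) | tri> _ _ gt rewrite lowerKind-beyond j (suc m) gt with h
... | ()

CutRect-intro : ∀ m n ne sw se r c → r ≤ suc m → c ≤ n → AvoidsCut (suc m) n ne sw se r c →
                (r , c) ∈ᶜ CutRect 0 0 (suc m) n ne sw se
CutRect-intro m n ne sw se zero c _ cn (fne , _ , _) = member top refl z≤n (below-dec← ne cn (λ q → fne q refl))
  where
  member : ∀ k → relKind 0 (suc m) ≡ k → kindLo k 0 sw ≤ c → c < kindHi k 0 n ne se →
           (0 , c) ∈ᶜ CutRect 0 0 (suc m) n ne sw se
  member k refl p q = Reg-intro {cutLo 0 0 (suc m) n ne sw se} {cutHi 0 0 (suc m) n ne sw se} {0} {c} p q
CutRect-intro m n ne sw se (suc j) c rm cn (_ , fsw , fse) with <-cmp j m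
... | tri< lt _ _ = member mid (lowerKind-mid j (suc m) (s≤s lt)) z≤n (s≤s cn)
  where
  member : ∀ k → lowerKind j (suc m) ≡ k → kindLo k 0 sw ≤ c → c < kindHi k 0 n ne se →
           (suc j , c) ∈ᶜ CutRect 0 0 (suc m) n ne sw se
  member k refl p q = Reg-intro {cutLo 0 0 (suc m) n ne sw se} {cutHi 0 0 (suc m) n ne sw se} {suc j} {c} p q
... | tri≈ _ refl _ = member last (lowerKind-last j) (above-inc← sw (λ q → fsw q refl)) (below-dec← se cn (λ q → fse q refl))
  where
  member : ∀ k → lowerKind j (suc j) ≡ k → kindLo k 0 sw ≤ c → c < kindHi k 0 n ne se →
           (suc j , c) ∈ᶜ CutRect 0 0 (suc j) n ne sw se
  member k refl p q = Reg-intro {cutLo 0 0 (suc j) n ne sw se} {cutHi 0 0 (suc j) n ne sw se} {suc j} {c} p q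
... | tri> _ _ gt = ⊥-elim (<-irrefl refl (<-≤-trans gt (≤-pred rm)))

NotCorner : ℕ → ℕ → Corner → ℕ → ℕ → Set
NotCorner M N k r c = ¬ (proj₁ (cornerCell M N k) ≡ r × proj₂ (cornerCell M N k) ≡ c)

cellEq-false→ : ∀ {x y r c} → cellEq (x , y) (r , c) ≡ false → ¬ (x ≡ r × y ≡ c)
cellEq-false→ {x} {y} e (refl , refl) = true≢false (∧-intro (T⇒true (≡⇒≡ᵇ x x refl)) (T⇒true (≡⇒≡ᵇ y y refl))) e

cellEq-false← : ∀ {x y r c} → ¬ (x ≡ r × y ≡ c) → cellEq (x , y) (r , c) ≡ false
cellEq-false← {x} {y} {r} {c} h =
  ¬true⇒false (λ e → h (≡ᵇ⇒≡ x r (true⇒T (∧-l e)) , ≡ᵇ⇒≡ y c (true⇒T (∧-r {x ≡ᵇ r} e))))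

∨-false-elim : ∀ {a b} → a ∨ b ≡ false → a ≡ false × b ≡ false
∨-false-elim {false} e = refl , e

any-false→All : ∀ M N r c (X : List Corner) → any (λ k → cellEq (cornerCell M N k) (r , c)) X ≡ false →
                All (λ k → NotCorner M N k r c) X
any-false→All M N r c [] _ = []
any-false→All M N r c (k ∷ X) e with ∨-false-elim {cellEq (cornerCell M N k) (r , c)} e
... | (ek , eX) = cellEq-false→ ek ∷ any-false→All M N r c X eX

All→any-false : ∀ M N r c (X : List Corner) → All (λ k → NotCorner M N k r c) X →
                any (λ k → cellEq (cornerCell M N k) (r , c)) X ≡ false
All→any-false M N r c [] _ = refl
All→any-false M N r c (k ∷ X) (h ∷ hs) rewrite cellEq-false← h = All→any-false M N r c X hs

rectMinus-elim : ∀ M N X r c → (r , c) ∈ᶜ rectMinus M N X → r < M × c < N × All (λ k → NotCorner M N k r c) X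
rectMinus-elim M N X r c e =
  <ᵇ⇒< r M (true⇒T (∧-l (∧-l e))) , <ᵇ⇒< c N (true⇒T (∧-r {r <ᵇ M} (∧-l e))) ,
  any-false→All M N r c X (not-true (∧-r {rect M N (r , c)} e))

rectMinus-intro : ∀ M N X r c → r < M → c < N → All (λ k → NotCorner M N k r c) X → (r , c) ∈ᶜ rectMinus M N X
rectMinus-intro M N X r c p q h = ∧-intro (∧-intro (T⇒true (<⇒<ᵇ p)) (T⇒true (<⇒<ᵇ q))) (not-intro (All→any-false M N r c X h))

_==ᶜ_ : Corner → Corner → Bool
NW ==ᶜ NW = true
NE ==ᶜ NE = true
SW ==ᶜ SW = true
SE ==ᶜ SE = true
_ ==ᶜ _ = false

removes : List Corner → Corner → Bool
removes X k = any (_==ᶜ k) X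

module _ (m n r c : ℕ) where
  avoids⇒cut : ∀ X → removes X NW ≡ false → All (λ k → NotCorner (suc m) (suc n) k r c) X →
               AvoidsCut m n (removes X NE) (removes X SW) (removes X SE) r c
  avoids⇒cut [] _ [] = (λ ()) , (λ ()) , (λ ())
  avoids⇒cut (NW ∷ X) () _
  avoids⇒cut (NE ∷ X) noNW (ok ∷ oks) with avoids⇒cut X noNW oks
  ... | (_ , fsw , fse) = (λ _ e₁ e₂ → ok (sym e₁ , sym e₂)) , fsw , fse
  avoids⇒cut (SW ∷ X) noNW (ok ∷ oks) with avoids⇒cut X noNW oks
  ... | (fne , _ , fse) = fne , (λ _ e₁ e₂ → ok (sym e₁ , sym e₂)) , fse
  avoids⇒cut (SE ∷ X) noNW (ok ∷ oks) with avoids⇒cut X noNW oks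
  ... | (fne , fsw , _) = fne , fsw , (λ _ e₁ e₂ → ok (sym e₁ , sym e₂))

  cut⇒avoids : ∀ X → removes X NW ≡ false → AvoidsCut m n (removes X NE) (removes X SW) (removes X SE) r c →
               All (λ k → NotCorner (suc m) (suc n) k r c) X
  cut⇒avoids [] _ _ = []
  cut⇒avoids (NW ∷ X) () _
  cut⇒avoids (NE ∷ X) noNW (fne , fsw , fse) =
    (λ (e₁ , e₂) → fne refl (sym e₁) (sym e₂)) ∷ cut⇒avoids X noNW ((λ _ → fne refl) , fsw , fse)
  cut⇒avoids (SW ∷ X) noNW (fne , fsw , fse) =
    (λ (e₁ , e₂) → fsw refl (sym e₁) (sym e₂)) ∷ cut⇒avoids X noNW (fne , (λ _ → fsw refl) , fse)
  cut⇒avoids (SE ∷ X) noNW (fne , fsw , fse) =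
    (λ (e₁ , e₂) → fse refl (sym e₁) (sym e₂)) ∷ cut⇒avoids X noNW (fne , fsw , (λ _ → fse refl))

rectMinus≐CutRect : ∀ m n X → removes X NW ≡ false →
  rectMinus (suc (suc m)) (suc n) X ≐ CutRect 0 0 (suc m) n (removes X NE) (removes X SW) (removes X SE)
rectMinus≐CutRect m n X noNW (r , c) = bool-ext
  (λ e → let (p , q , h) = rectMinus-elim (suc (suc m)) (suc n) X r c e in
         CutRect-intro m n _ _ _ r c (≤-pred p) (≤-pred q) (avoids⇒cut (suc m) n r c X noNW h))
  (λ e → let (p , q , cut) = CutRect-elim m n _ _ _ r c e in
         rectMinus-intro (suc (suc m)) (suc n) X r c (s≤s p) (s≤s q) (cut⇒avoids (suc m) n r c X noNW cut))

rectMinus-count : ∀ m n X → removes X NW ≡ false →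
  NumTilings (rectMinus (3 + m) (3 + n) X) (count (2 + m) (2 + n) (removes X NE) (removes X SW) (removes X SE))
rectMinus-count m n X noNW =
  NumTilings-resp (≐-sym (rectMinus≐CutRect (suc m) (suc (suc n)) X noNW))
    (cutRect-count (2 + m) (2 + n) _ _ _ 0 0 big (λ ()))
  where
  big : ∀ {ne sw se} → Valid (2 + m) (2 + n) ne sw se
  big = record { ne-room = λ _ → s≤s z≤n , s≤s z≤n ; not-diagonal = λ () ; sw-room = λ _ → inj₂ (s≤s z≤n) }

-- Closed forms.  paths m n = (m + n) C m is given by Pascal's recursion;
-- the counts with cut corners differ from the uncut ones by constants or
-- by 'paths', which is proved by unfolding the recursion of 'count'.

paths : ℕ → ℕ → ℕ
paths zero n = 1
paths (suc m) zero = 1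
paths (suc m) (suc n) = paths m (suc n) + paths (suc m) n

nC0≡1 : ∀ n → n C 0 ≡ 1
nC0≡1 n = trans (nCk≡nC[n∸k] {0} {n} z≤n) (nCn≡1 n)

paths≡binomial : ∀ m n → paths m n ≡ (m + n) C m
paths≡binomial zero n = sym (nC0≡1 n)
paths≡binomial (suc m) zero = sym (trans (cong (_C suc m) (+-identityʳ (suc m))) (nCn≡1 (suc m)))
paths≡binomial (suc m) (suc n) = begin
    paths m (suc n) + paths (suc m) n
  ≡⟨ cong₂ _+_ (paths≡binomial m (suc n)) (paths≡binomial (suc m) n) ⟩
    (m + suc n) C m + (suc m + n) C suc m
  ≡⟨ cong (λ x → x C m + (suc m + n) C suc m) (+-suc m n) ⟩
    suc (m + n) C m + suc (m + n) C suc m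
  ≡⟨ nCk+nC[k+1]≡[n+1]C[k+1] (suc (m + n)) m ⟩
    suc (suc (m + n)) C suc m
  ≡⟨ cong (λ x → suc x C suc m) (sym (+-suc m n)) ⟩
    (suc m + suc n) C suc m
  ∎
  where open ≡-Reasoning

binomial-shift : ∀ m n → (suc m + suc n ∸ 2) C (suc m ∸ 1) ≡ paths m n
binomial-shift m n = trans (cong (λ x → (x ∸ 1) C m) (+-suc m n)) (sym (paths≡binomial m n))

paths-1 : ∀ n → paths 1 n ≡ suc n
paths-1 zero = refl
paths-1 (suc n) = cong suc (paths-1 n)

paths-column : ∀ m → paths m 1 ≡ suc m
paths-column zero = refl
paths-column (suc m) = trans (cong (_+ 1) (paths-column m)) (+-comm (suc m) 1)

columnCount-uncut : ∀ m → columnCount m false ≡ m + 2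
columnCount-uncut zero = refl
columnCount-uncut (suc m) = trans (cong (_+ 1) (columnCount-uncut m)) (+-comm (m + 2) 1)

columnCount-cut : ∀ m → columnCount m true + 1 ≡ columnCount m false
columnCount-cut zero = refl
columnCount-cut (suc m) = cong (_+ 1) (columnCount-cut m)

southCount-uncut : ∀ m n se → southCount m n false se ≡ count (suc m) n false false se
southCount-uncut m zero se = refl
southCount-uncut m (suc n) se = refl

full-count : ∀ m n → count m n false false false + paths m n ≡ paths (suc m) (suc n)
full-count zero n = trans (+-comm (suc n) 1) (cong suc (sym (paths-1 n)))
full-count (suc m) zero = begin
    columnCount m false + 1   ≡⟨ cong (_+ 1) (columnCount-uncut m) ⟩
    (m + 2) + 1               ≡⟨ cong (_+ 1) (+-comm m 2) ⟩
    suc (suc m) + 1           ≡⟨ cong (_+ 1) (sym (paths-column (suc m))) ⟩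
    paths (suc m) 1 + 1       ∎
  where open ≡-Reasoning
full-count (suc m) (suc n) = begin
    (count m (suc n) false false false + southCount m n false false) + (paths m (suc n) + paths (suc m) n)
  ≡⟨ cong (λ z → (count m (suc n) false false false + z) + (paths m (suc n) + paths (suc m) n)) (southCount-uncut m n false) ⟩
    (count m (suc n) false false false + count (suc m) n false false false) + (paths m (suc n) + paths (suc m) n)
  ≡⟨ +-interchange (count m (suc n) false false false) _ (paths m (suc n)) _ ⟩
    (count m (suc n) false false false + paths m (suc n)) + (count (suc m) n false false false + paths (suc m) n)
  ≡⟨ cong₂ _+_ (full-count m (suc n)) (full-count (suc m) n) ⟩
    paths (suc m) (suc (suc n)) + paths (suc (suc m)) (suc n)
  ∎
  where open ≡-Reasoning

mutual
  SE-cut : ∀ m n → count (suc m) n false false true + paths (suc m) n ≡ count (suc m) n false false false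
  SE-cut m zero = columnCount-cut m
  SE-cut m (suc n) = begin
      (count m (suc n) false false true + southCount m n false true) + (paths m (suc n) + paths (suc m) n)
    ≡⟨ cong (λ z → (count m (suc n) false false true + z) + (paths m (suc n) + paths (suc m) n)) (southCount-uncut m n true) ⟩
      (count m (suc n) false false true + count (suc m) n false false true) + (paths m (suc n) + paths (suc m) n)
    ≡⟨ +-interchange (count m (suc n) false false true) _ (paths m (suc n)) _ ⟩
      (count m (suc n) false false true + paths m (suc n)) + (count (suc m) n false false true + paths (suc m) n)
    ≡⟨ cong₂ _+_ (SE-cut-wide m n) (SE-cut m n) ⟩
      count m (suc n) false false false + count (suc m) n false false false
    ≡⟨ cong (count m (suc n) false false false +_) (sym (southCount-uncut m n false)) ⟩
      count m (suc n) false false false + southCount m n false false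
    ∎
    where open ≡-Reasoning

  SE-cut-wide : ∀ m n → count m (suc n) false false true + paths m (suc n) ≡ count m (suc n) false false false
  SE-cut-wide zero n = +-comm (suc n) 1
  SE-cut-wide (suc m) n = SE-cut m (suc n)

NE-cut-south : ∀ m n se → southCount (suc m) n true se + 1 ≡ southCount (suc m) n false se
NE-cut-south m zero se = refl
NE-cut-south m (suc n) se = begin
    (count (suc m) (suc n) false false se + southCount (suc m) n true se) + 1
  ≡⟨ +-assoc (count (suc m) (suc n) false false se) _ 1 ⟩
    count (suc m) (suc n) false false se + (southCount (suc m) n true se + 1)
  ≡⟨ cong (count (suc m) (suc n) false false se +_) (NE-cut-south m n se) ⟩
    count (suc m) (suc n) false false se + southCount (suc m) n false se
  ∎
  where open ≡-Reasoning

NE-cut : ∀ m n se → count (2 + m) (suc n) true false se + 1 ≡ count (2 + m) (suc n) false false se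
NE-cut m n se = trans (+-assoc (count (suc m) (suc n) false false se) _ 1)
                      (cong (count (suc m) (suc n) false false se +_) (NE-cut-south m n se))

SW-cut : ∀ m n se → count m (2 + n) false true se + 1 ≡ count m (2 + n) false false se
SW-cut zero n false = +-comm (suc (suc n)) 1
SW-cut zero n true = +-comm (suc n) 1
SW-cut (suc m) n se = begin
    (count m (2 + n) false true se + southCount m (suc n) false se) + 1
  ≡⟨ +-interchange (count m (2 + n) false true se) (southCount m (suc n) false se) 1 0 ⟩
    (count m (2 + n) false true se + 1) + (southCount m (suc n) false se + 0)
  ≡⟨ cong₂ _+_ (SW-cut m n se) (+-identityʳ _) ⟩
    count m (2 + n) false false se + southCount m (suc n) false se
  ∎
  where open ≡-Reasoning

NE-SW-cut : ∀ m n se → count (2 + m) (2 + n) true true se + 2 ≡ count (2 + m) (2 + n) false false se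
NE-SW-cut m n se = begin
    (count (suc m) (2 + n) false true se + southCount (suc m) (suc n) true se) + (1 + 1)
  ≡⟨ +-interchange (count (suc m) (2 + n) false true se) _ 1 1 ⟩
    (count (suc m) (2 + n) false true se + 1) + (southCount (suc m) (suc n) true se + 1)
  ≡⟨ cong₂ _+_ (SW-cut (suc m) n se) (NE-cut-south m (suc n) se) ⟩
    count (suc m) (2 + n) false false se + southCount (suc m) (suc n) false se
  ∎
  where open ≡-Reasoning

full-binomial : ∀ m n → count m n false false false + (suc m + suc n ∸ 2) C (suc m ∸ 1) ≡ (suc m + suc n) C suc m
full-binomial m n = begin
    count m n false false false + (suc m + suc n ∸ 2) C (suc m ∸ 1)
  ≡⟨ cong (count m n false false false +_) (binomial-shift m n) ⟩
    count m n false false false + paths m n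
  ≡⟨ full-count m n ⟩
    paths (suc m) (suc n)
  ≡⟨ paths≡binomial (suc m) (suc n) ⟩
    (suc m + suc n) C suc m
  ∎
  where open ≡-Reasoning

SE-binomial : ∀ m n → count (suc m) (suc n) false false true + 2 * ((2 + m + (2 + n) ∸ 2) C (2 + m ∸ 1)) ≡
                      (2 + m + (2 + n)) C (2 + m)
SE-binomial m n = begin
    Tse + 2 * ((2 + m + (2 + n) ∸ 2) C (2 + m ∸ 1))
  ≡⟨ cong (λ x → Tse + 2 * x) (binomial-shift (suc m) (suc n)) ⟩
    Tse + (P + (P + 0))
  ≡⟨ cong (λ x → Tse + (P + x)) (+-identityʳ P) ⟩
    Tse + (P + P)
  ≡⟨ sym (+-assoc Tse P P) ⟩
    (Tse + P) + P
  ≡⟨ cong (_+ P) (SE-cut m (suc n)) ⟩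
    count (suc m) (suc n) false false false + P
  ≡⟨ full-count (suc m) (suc n) ⟩
    paths (2 + m) (2 + n)
  ≡⟨ paths≡binomial (2 + m) (2 + n) ⟩
    (2 + m + (2 + n)) C (2 + m)
  ∎
  where
  open ≡-Reasoning
  Tse = count (suc m) (suc n) false false true
  P = paths (suc m) (suc n)

corollary4p8 : (m n : ℕ) → 3 ≤ m → 3 ≤ n →
    Σ[ T ∈ ℕ ] Σ[ Tse ∈ ℕ ] Σ[ Tnesw ∈ ℕ ] Σ[ Tnese ∈ ℕ ] Σ[ Tswse ∈ ℕ ] Σ[ Tneswse ∈ ℕ ]
      ( NumTilings (rectMinus m n []) T
      × NumTilings (rectMinus m n (SE ∷ [])) Tse
      × NumTilings (rectMinus m n (NE ∷ SW ∷ [])) Tnesw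
      × NumTilings (rectMinus m n (NE ∷ SE ∷ [])) Tnese
      × NumTilings (rectMinus m n (SW ∷ SE ∷ [])) Tswse
      × NumTilings (rectMinus m n (NE ∷ SW ∷ SE ∷ [])) Tneswse
      × Tnesw + 2 ≡ T
      × T + (m + n ∸ 2) C (m ∸ 1) ≡ (m + n) C m
      × Tnese ≡ Tswse
      × Tnese + 1 ≡ Tse
      × Tse + 2 * ((m + n ∸ 2) C (m ∸ 1)) ≡ (m + n) C m
      × Tneswse + 2 ≡ Tse )
corollary4p8 (suc (suc (suc a))) (suc (suc (suc b))) (s≤s (s≤s (s≤s _))) (s≤s (s≤s (s≤s _))) =
  _ , _ , _ , _ , _ , _ ,
  rectMinus-count a b [] refl ,
  rectMinus-count a b (SE ∷ []) refl ,
  rectMinus-count a b (NE ∷ SW ∷ []) refl ,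
  rectMinus-count a b (NE ∷ SE ∷ []) refl ,
  rectMinus-count a b (SW ∷ SE ∷ []) refl ,
  rectMinus-count a b (NE ∷ SW ∷ SE ∷ []) refl ,
  NE-SW-cut a b false ,
  full-binomial (2 + a) (2 + b) ,
  +-cancelʳ-≡ 1 _ _ (trans (NE-cut a (suc b) true) (sym (SW-cut (2 + a) b true))) ,
  NE-cut a (suc b) true ,
  SE-binomial (suc a) (suc b) ,
  NE-SW-cut a b true
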